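{- Let $r\ge 0$ be an integer and, for integers $n\ge 0$ and $k$, let $S^B(n,k,r)$ be the number of signed set partitions of $[n]$ with exactly $k$ non-zero block pairs in which each of $1,\dots,r$ lies in a non-zero block and the block pairs containing $\pm1,\dots,\pm r$ are pairwise distinct (with $S^B(n,k,r)=0$ for $k<0$). Then: if $n<r$, $S^B(n,k,r)=0$; if $n=r$, $S^B(n,k,r)=\delta_{kr}$; and if $n>r$, $$S^B(n,k,r)=S^B(n-1,k-1,r)+(2k+1)\,S^B(n-1,k,r).$$
   Context: Let $[\pm n]=\{\pm1,\dots,\pm n\}$. A signed set partition (set partition of type $B$) of $[n]$ is a set partition of $[\pm n]$ such that (i) whenever $B$ is a block, $-B=\{ -x: x\in B\}$ is also a block, and (ii) at most one block satisfies $B=-B$; this block, if it exists, is called the zero block. The remaining blocks come in pairs $\{B,-B\}$ with $B\neq -B$; these are the non-zero block pairs. $\delta_{kr}$ is the Kronecker delta. -}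

module Defs where

open import Data.Bool using (Bool; true; false; not; _∧_; _∨_; _xor_; if_then_else_)
open import Data.Nat using (ℕ; zero; suc; _+_; _*_; _<ᵇ_; _≤ᵇ_; _≡ᵇ_)
open import Data.Fin using (Fin; zero; suc; toℕ; _↑ˡ_; _↑ʳ_; splitAt; combine)
open import Data.Sum using (inj₁; inj₂)
open import Data.Integer using (ℤ; +_) renaming (_*_ to _*ℤ_)
import Data.Integer as ℤ
open import Relation.Nullary.Decidable using (⌊_⌋)

allFin : (m : ℕ) → (Fin m → Bool) → Bool
allFin zero    p = true
allFin (suc m) p = p zero ∧ allFin m (λ i → p (suc i))

countFin : (m : ℕ) → (Fin m → Bool) → ℕ
countFin zero    p = zero
countFin (suc m) p = (if p zero then 1 else 0) + countFin m (λ i → p (suc i))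

extend : {m : ℕ} → Bool → (Fin m → Bool) → Fin (suc m) → Bool
extend b f zero    = b
extend b f (suc i) = f i

countFun : (m : ℕ) → ((Fin m → Bool) → Bool) → ℕ
countFun zero    P = if P (λ ()) then 1 else 0
countFun (suc m) P = countFun m (λ f → P (extend true f)) + countFun m (λ f → P (extend false f))

_⇒ᵇ_ : Bool → Bool → Bool
a ⇒ᵇ b = not a ∨ b

-- The ground set [±n] is Fin (n + n): pos i (i : Fin n) stands for the
-- element  toℕ i + 1  and negP i for  -(toℕ i + 1).
Pt : ℕ → Set
Pt n = Fin (n + n)

pos : {n : ℕ} → Fin n → Pt n
pos {n} i = i ↑ˡ n

negP : {n : ℕ} → Fin n → Pt n
negP {n} i = n ↑ʳ i

negate : {n : ℕ} → Pt n → Pt n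
negate {n} x with splitAt n x
... | inj₁ i = negP i
... | inj₂ i = pos i

-- A set partition of [±n] is encoded by its equivalence relation
-- (x ~ y iff x and y lie in the same block), as a Boolean relation.
Rel : ℕ → Set
Rel n = Pt n → Pt n → Bool

isEquivalence : (n : ℕ) → Rel n → Bool
isEquivalence n R =
  allFin (n + n) (λ x → R x x) ∧
  allFin (n + n) (λ x → allFin (n + n) (λ y → R x y ⇒ᵇ R y x)) ∧
  allFin (n + n) (λ x → allFin (n + n) (λ y → allFin (n + n) (λ z →
    (R x y ∧ R y z) ⇒ᵇ R x z)))

-- (i) B a block ⇒ -B a block   (x ~ y iff -x ~ -y)
negClosed : (n : ℕ) → Rel n → Bool
negClosed n R =
  allFin (n + n) (λ x → allFin (n + n) (λ y → not (R x y xor R (negate {n} x) (negate {n} y))))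

-- the block of x is a zero block (B = -B) iff x ~ -x
inZeroBlock : {n : ℕ} → Rel n → Pt n → Bool
inZeroBlock {n} R x = R x (negate {n} x)

-- (ii) at most one block with B = -B
atMostOneZero : (n : ℕ) → Rel n → Bool
atMostOneZero n R =
  allFin (n + n) (λ x → allFin (n + n) (λ y →
    (inZeroBlock {n} R x ∧ inZeroBlock {n} R y) ⇒ᵇ R x y))

isSignedPartition : (n : ℕ) → Rel n → Bool
isSignedPartition n R = isEquivalence n R ∧ negClosed n R ∧ atMostOneZero n R

-- number of non-zero blocks: count the least element of each non-zero block
nonZeroBlocks : (n : ℕ) → Rel n → ℕ
nonZeroBlocks n R = countFin (n + n) (λ x →
  not (inZeroBlock {n} R x) ∧ allFin (n + n) (λ y → (toℕ y <ᵇ toℕ x) ⇒ᵇ not (R x y)))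

-- exactly k non-zero block pairs  (⇔ 2k non-zero blocks)
hasPairs : (n : ℕ) → ℤ → Rel n → Bool
hasPairs n k R = ⌊ (+ nonZeroBlocks n R) ℤ.≟ (+ 2) *ℤ k ⌋

rCondition : (n r : ℕ) → Rel n → Bool
rCondition n r R =
  (r ≤ᵇ n) ∧
  allFin n (λ i → (toℕ i <ᵇ r) ⇒ᵇ not (R (pos i) (negP i))) ∧
  allFin n (λ i → allFin n (λ j →
    ((toℕ i <ᵇ r) ∧ (toℕ j <ᵇ r) ∧ not (toℕ i ≡ᵇ toℕ j)) ⇒ᵇ
      (not (R (pos i) (pos j)) ∧ not (R (pos i) (negP j)))))

-- relations on Pt n correspond bijectively (via combine) to Fin ((n+n)*(n+n)) → Bool
toRel : (n : ℕ) → (Fin ((n + n) * (n + n)) → Bool) → Rel n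
toRel n f x y = f (combine x y)

SB : ℕ → ℤ → ℕ → ℕ
SB n k r = countFun ((n + n) * (n + n)) (λ f →
  isSignedPartition n (toRel n f) ∧ hasPairs n k (toRel n f) ∧ rCondition n r (toRel n f))

δ : ℤ → ℤ → ℕ
δ a b = if ⌊ a ℤ.≟ b ⌋ then 1 else 0

module Submission where

-- Read the elements 1, …, n in order and record a signed partition as a word whose i-th letter says what
-- happens to ±i: i opens a new block pair (pairs are numbered in order of opening, i on the positive side),
-- i joins the zero block, or i joins one of the two sides of an earlier pair.  Labelling every point of
-- [±n] by its block inverts this, so signed partitions and words correspond bijectively; a word opening k
-- pairs has 2k non-zero blocks, and 1, …, r lie in distinct non-zero block pairs iff the first r letters
-- all open a pair.  Sorting words by their last letter then gives the recurrence when n > r: the last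
-- letter opens a pair (S^B(n-1,k-1,r) words) or is one of the 2k + 1 remaining letters (S^B(n-1,k,r)
-- words each).  For n = r every letter must open a pair, and for n < r no word qualifies.

open import Defs

module SignedPartitionCodes where

  open import Data.Bool using (Bool; true; false; not; T; _∧_; _∨_; _xor_; if_then_else_)
  open import Data.Bool.Properties using (T-≡; ¬-not; ⇔→≡; ∧-identityʳ; ∧-zeroʳ; not-involutive)
  import Data.Bool as Bool
  import Data.Nat as ℕ
  open import Data.Nat using (ℕ; zero; suc; _+_; _*_; _≤_; _<_; z≤n; s≤s; _≡ᵇ_; _<ᵇ_; _≤ᵇ_)
  open import Data.Nat.Properties
    using ( 1+n≢n; ≡ᵇ⇒≡; ≡⇒≡ᵇ; <ᵇ⇒<; <⇒<ᵇ; ≤ᵇ⇒≤; ≤⇒≤ᵇ; n≤0⇒n≡0; m≤n⇒m<n∨m≡n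
          ; ≤-refl; ≤-reflexive; ≤-trans; <-irrefl; ≤-antisym; <-cmp; n≤1+n; m≤n⇒m≤1+n
          ; +-identityʳ; *-comm; *-identityʳ; *-zeroʳ; *-distribˡ-+; +-commutativeSemigroup; +-*-semiring )
  open import Algebra.Properties.Semiring.Sum +-*-semiring
    using (sum; sum-cong-≗; sum-replicate-zero; ∑-distrib-+; *-distribˡ-sum)
  open import Algebra.Properties.CommutativeSemigroup +-commutativeSemigroup
    using () renaming (interchange to +-interchange)
  open import Data.Integer using (ℤ)
  import Data.Integer as ℤ
  import Data.Integer.Properties as ℤ
  open import Data.Fin using (Fin; zero; suc; toℕ; splitAt; fromℕ; fromℕ<; inject₁; combine; remQuot)
  open import Data.Fin.Properties
    using ( suc-injective; toℕ-injective; _≟_; any?; toℕ<n; fromℕ≢inject₁; toℕ-fromℕ; toℕ-fromℕ<; toℕ-inject₁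
          ; splitAt-↑ˡ; splitAt-↑ʳ; splitAt⁻¹-↑ˡ; splitAt⁻¹-↑ʳ; remQuot-combine; combine-remQuot )
  open import Data.Product using (Σ; _×_; _,_; proj₁; proj₂)
  open import Data.Sum using (_⊎_; inj₁; inj₂)
  open import Data.Empty using (⊥; ⊥-elim)
  open import Function.Bundles using (Equivalence; mk⇔)
  open import Relation.Nullary using (Dec; yes; no; does)
  open import Relation.Nullary.Decidable as Dec using (⌊_⌋; isYes≗does; dec-true; dec-false; does-⇔; _×-dec_)
  open import Relation.Binary.Definitions using (DecidableEquality; tri<; tri≈; tri>)
  open import Relation.Binary.PropositionalEquality hiding (isEquivalence)
  open ≡-Reasoning

  ≡true⇒T : ∀ {b} → b ≡ true → T b
  ≡true⇒T = Equivalence.from T-≡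

  T⇒≡true : ∀ {b} → T b → b ≡ true
  T⇒≡true = Equivalence.to T-≡

  true-ext : ∀ {a b} → (a ≡ true → b ≡ true) → (b ≡ true → a ≡ true) → a ≡ b
  true-ext f g = ⇔→≡ (mk⇔ f g)

  false≢true : ∀ {a} → a ≡ false → a ≡ true → ⊥
  false≢true refl ()

  ∧-elimˡ : ∀ {a b} → a ∧ b ≡ true → a ≡ true
  ∧-elimˡ {true} _ = refl

  ∧-elimʳ : ∀ {a b} → a ∧ b ≡ true → b ≡ true
  ∧-elimʳ {true} e = e

  ∧-intro : ∀ {a b} → a ≡ true → b ≡ true → a ∧ b ≡ true
  ∧-intro refl refl = refl

  ⇒ᵇ-elim : ∀ {a b} → (a ⇒ᵇ b) ≡ true → a ≡ true → b ≡ true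
  ⇒ᵇ-elim {true} e refl = e

  ⇒ᵇ-intro : ∀ {a b} → (a ≡ true → b ≡ true) → (a ⇒ᵇ b) ≡ true
  ⇒ᵇ-intro {true} f = f refl
  ⇒ᵇ-intro {false} f = refl

  not-elim : ∀ {a} → not a ≡ true → a ≡ false
  not-elim {false} _ = refl

  not-intro : ∀ {a} → a ≡ false → not a ≡ true
  not-intro refl = refl

  not-xor-elim : ∀ {a b} → not (a xor b) ≡ true → a ≡ b
  not-xor-elim {true} {true} _ = refl
  not-xor-elim {false} {false} _ = refl

  not-xor-intro : ∀ {a b} → a ≡ b → not (a xor b) ≡ true
  not-xor-intro {true} refl = refl
  not-xor-intro {false} refl = refl

  does-sound : ∀ {P : Set} (d : Dec P) → does d ≡ true → P
  does-sound (yes p) _ = p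

  ≡ᵇ-false : ∀ {a b} → a ≢ b → (a ≡ᵇ b) ≡ false
  ≡ᵇ-false {a} {b} a≢b = ¬-not (λ e → a≢b (≡ᵇ⇒≡ a b (≡true⇒T e)))

  indicator : Bool → ℕ
  indicator b = if b then 1 else 0

  allFin-elim : ∀ m {p : Fin m → Bool} → allFin m p ≡ true → ∀ i → p i ≡ true
  allFin-elim (suc m) e zero = ∧-elimˡ e
  allFin-elim (suc m) e (suc i) = allFin-elim m (∧-elimʳ e) i

  allFin-intro : ∀ m {p : Fin m → Bool} → (∀ i → p i ≡ true) → allFin m p ≡ true
  allFin-intro zero f = refl
  allFin-intro (suc m) f = ∧-intro (f zero) (allFin-intro m (λ i → f (suc i)))

  allFin-cong : ∀ m {p q : Fin m → Bool} → (∀ i → p i ≡ q i) → allFin m p ≡ allFin m q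
  allFin-cong zero f = refl
  allFin-cong (suc m) f = cong₂ _∧_ (f zero) (allFin-cong m (λ i → f (suc i)))

  countFin-cong : ∀ m {p q : Fin m → Bool} → (∀ i → p i ≡ q i) → countFin m p ≡ countFin m q
  countFin-cong zero f = refl
  countFin-cong (suc m) f = cong₂ _+_ (cong indicator (f zero)) (countFin-cong m (λ i → f (suc i)))

  countFin-true : ∀ m → countFin m (λ _ → true) ≡ m
  countFin-true zero = refl
  countFin-true (suc m) = cong suc (countFin-true m)

  countFin-remove : ∀ m (q : Fin m → Bool) (y : Fin m) → q y ≡ true →
    countFin m q ≡ suc (countFin m (λ z → q z ∧ not (does (z ≟ y))))
  countFin-remove (suc m) q zero qy rewrite qy =
    cong suc (countFin-cong m (λ i → sym (∧-identityʳ (q (suc i)))))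
  countFin-remove (suc m) q (suc y) qy with q zero
  ... | true = cong suc (countFin-remove m (λ i → q (suc i)) y qy)
  ... | false = countFin-remove m (λ i → q (suc i)) y qy

  countFin-≤-injection : ∀ a b (p : Fin a → Bool) (q : Fin b → Bool)
    (f : (x : Fin a) → p x ≡ true → Fin b) →
    (∀ x px → q (f x px) ≡ true) →
    (∀ x y px py → f x px ≡ f y py → x ≡ y) →
    countFin a p ≤ countFin b q
  countFin-≤-injection zero b p q f fq f-inj = z≤n
  countFin-≤-injection (suc a) b p q f fq f-inj with p zero in p0
  ... | false = countFin-≤-injection a b (λ i → p (suc i)) q (λ x → f (suc x)) (λ x → fq (suc x))
                  (λ x y px py eq → suc-injective (f-inj (suc x) (suc y) px py eq))
  ... | true = ≤-trans (s≤s rest) (≤-reflexive (sym (countFin-remove b q y₀ (fq zero p0))))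
    where
    y₀ = f zero p0
    misses-y₀ : ∀ x px → f (suc x) px ≢ y₀
    misses-y₀ x px eq with f-inj (suc x) zero px p0 eq
    ... | ()
    rest = countFin-≤-injection a b (λ i → p (suc i)) (λ z → q z ∧ not (does (z ≟ y₀)))
             (λ x → f (suc x))
             (λ x px → ∧-intro (fq (suc x) px) (not-intro (dec-false (_ ≟ y₀) (misses-y₀ x px))))
             (λ x y px py eq → suc-injective (f-inj (suc x) (suc y) px py eq))

  countFun-cong : ∀ m {P Q : (Fin m → Bool) → Bool} → (∀ f → P f ≡ Q f) →
    countFun m P ≡ countFun m Q
  countFun-cong zero e = cong indicator (e _)
  countFun-cong (suc m) e = cong₂ _+_ (countFun-cong m (λ f → e _)) (countFun-cong m (λ f → e _))

  countFun-false : ∀ m {P : (Fin m → Bool) → Bool} → (∀ f → P f ≡ false) → countFun m P ≡ 0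
  countFun-false zero e = cong indicator (e _)
  countFun-false (suc m) e = cong₂ _+_ (countFun-false m (λ f → e _)) (countFun-false m (λ f → e _))

  countFun-∨ : ∀ m {P Q : (Fin m → Bool) → Bool} → (∀ f → P f ≡ true → Q f ≡ true → ⊥) →
    countFun m (λ f → P f ∨ Q f) ≡ countFun m P + countFun m Q
  countFun-∨ zero {P} {Q} disjoint = indicator-∨ (λ ())
    where
    indicator-∨ : ∀ f → indicator (P f ∨ Q f) ≡ indicator (P f) + indicator (Q f)
    indicator-∨ f with P f in p | Q f in q
    ... | true | true = ⊥-elim (disjoint f p q)
    ... | true | false = refl
    ... | false | _ = refl
  countFun-∨ (suc m) {P} {Q} disjoint
    rewrite countFun-∨ m {λ f → P (extend true f)} {λ f → Q (extend true f)} (λ f → disjoint _)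
          | countFun-∨ m {λ f → P (extend false f)} {λ f → Q (extend false f)} (λ f → disjoint _)
    = +-interchange (countFun m (λ f → P (extend true f))) (countFun m (λ f → Q (extend true f)))
                    (countFun m (λ f → P (extend false f))) (countFun m (λ f → Q (extend false f)))

  _≡ᶠ_ : ∀ {m} → (Fin m → Bool) → (Fin m → Bool) → Bool
  _≡ᶠ_ {m} f g = allFin m (λ i → not (f i xor g i))

  ≡ᶠ-elim : ∀ {m} (f g : Fin m → Bool) → f ≡ᶠ g ≡ true → ∀ i → f i ≡ g i
  ≡ᶠ-elim {m} f g e i = not-xor-elim (allFin-elim m e i)

  ≡ᶠ-intro : ∀ {m} (f g : Fin m → Bool) → (∀ i → f i ≡ g i) → f ≡ᶠ g ≡ true
  ≡ᶠ-intro {m} f g h = allFin-intro m (λ i → not-xor-intro (h i))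

  countFun-singleton : ∀ m (g : Fin m → Bool) (b : Bool) →
    countFun m (λ f → (f ≡ᶠ g) ∧ b) ≡ indicator b
  countFun-singleton zero g b = refl
  countFun-singleton (suc m) g b with g zero
  ... | true = trans (cong₂ _+_ (countFun-singleton m (λ i → g (suc i)) b) (countFun-false m (λ f → refl)))
                     (+-identityʳ _)
  ... | false = cong₂ _+_ (countFun-false m (λ f → refl)) (countFun-singleton m (λ i → g (suc i)) b)

  negate-pos : ∀ {n} (i : Fin n) → negate {n} (pos i) ≡ negP i
  negate-pos {n} i rewrite splitAt-↑ˡ n i n = refl

  negate-neg : ∀ {n} (i : Fin n) → negate {n} (negP i) ≡ pos i
  negate-neg {n} i rewrite splitAt-↑ʳ n n i = refl

  data PtView {n : ℕ} : Pt n → Set where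
    isPos : (i : Fin n) → PtView (pos i)
    isNeg : (i : Fin n) → PtView (negP i)

  ptView : ∀ {n} (x : Pt n) → PtView x
  ptView {n} x with splitAt n x in e
  ... | inj₁ i = subst PtView (splitAt⁻¹-↑ˡ e) (isPos i)
  ... | inj₂ i = subst PtView (splitAt⁻¹-↑ʳ e) (isNeg i)

  data LastView : ∀ {m} → Fin (suc m) → Set where
    isLast : ∀ {m} → LastView (fromℕ m)
    isInject : ∀ {m} (j : Fin m) → LastView (inject₁ j)

  lastView : ∀ {m} (i : Fin (suc m)) → LastView i
  lastView {zero} zero = isLast
  lastView {suc m} zero = isInject zero
  lastView {suc m} (suc i) with lastView i
  ... | isLast = isLast
  ... | isInject j = isInject (suc j)

  embed : ∀ {m} → Pt m → Pt (suc m)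
  embed {m} x with splitAt m x
  ... | inj₁ i = pos (inject₁ i)
  ... | inj₂ i = negP (inject₁ i)

  embed-pos : ∀ {m} (i : Fin m) → embed (pos i) ≡ pos (inject₁ i)
  embed-pos {m} i rewrite splitAt-↑ˡ m i m = refl

  embed-neg : ∀ {m} (i : Fin m) → embed (negP i) ≡ negP (inject₁ i)
  embed-neg {m} i rewrite splitAt-↑ʳ m m i = refl

  negate-embed : ∀ {m} (x : Pt m) → negate {suc m} (embed x) ≡ embed (negate {m} x)
  negate-embed {m} x with ptView {m} x
  ... | isPos i = trans (cong (negate {suc m}) (embed-pos i))
                    (trans (negate-pos {suc m} _) (sym (trans (cong embed (negate-pos {m} i)) (embed-neg i))))
  ... | isNeg i = trans (cong (negate {suc m}) (embed-neg i))
                    (trans (negate-neg {suc m} _) (sym (trans (cong embed (negate-neg {m} i)) (embed-pos i))))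

  new⁺ new⁻ : ∀ m → Pt (suc m)
  new⁺ m = pos (fromℕ m)
  new⁻ m = negP (fromℕ m)

  data ExtView {m : ℕ} : Pt (suc m) → Set where
    isNew⁺ : ExtView (new⁺ m)
    isNew⁻ : ExtView (new⁻ m)
    isOld : (y : Pt m) → ExtView (embed y)

  extView : ∀ {m} (x : Pt (suc m)) → ExtView x
  extView {m} x with ptView {suc m} x
  ... | isPos i with lastView i
  ...   | isLast = isNew⁺
  ...   | isInject j = subst ExtView (embed-pos j) (isOld (pos j))
  extView x | isNeg i with lastView i
  ...   | isLast = isNew⁻
  ...   | isInject j = subst ExtView (embed-neg j) (isOld (negP j))

  -- Codes and their labellings

  data Label : Set where
    zeroBlock : Label
    block : ℕ → Bool → Label

  block⁺ : ℕ → Label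
  block⁺ t = block t true

  block-injective : ∀ {t u s v} → block t s ≡ block u v → t ≡ u × s ≡ v
  block-injective refl = refl , refl

  _≟ᴸ_ : DecidableEquality Label
  zeroBlock ≟ᴸ zeroBlock = yes refl
  zeroBlock ≟ᴸ block _ _ = no λ ()
  block _ _ ≟ᴸ zeroBlock = no λ ()
  block t s ≟ᴸ block u v =
    Dec.map′ (λ (t≡u , s≡v) → cong₂ block t≡u s≡v) block-injective
             ((t ℕ.≟ u) ×-dec (s Bool.≟ v))

  _≈ᴸ_ : Label → Label → Bool
  a ≈ᴸ b = does (a ≟ᴸ b)

  ≈ᴸ-refl : ∀ a → a ≈ᴸ a ≡ true
  ≈ᴸ-refl a = dec-true (a ≟ᴸ a) refl

  ≈ᴸ-sound : ∀ a b → a ≈ᴸ b ≡ true → a ≡ b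
  ≈ᴸ-sound a b = does-sound (a ≟ᴸ b)

  ≈ᴸ-complete : ∀ a b → a ≡ b → a ≈ᴸ b ≡ true
  ≈ᴸ-complete a b = dec-true (a ≟ᴸ b)

  ≈ᴸ-false : ∀ a b → a ≢ b → a ≈ᴸ b ≡ false
  ≈ᴸ-false a b = dec-false (a ≟ᴸ b)

  negLabel : Label → Label
  negLabel zeroBlock = zeroBlock
  negLabel (block t s) = block t (not s)

  negLabel-involutive : ∀ a → negLabel (negLabel a) ≡ a
  negLabel-involutive zeroBlock = refl
  negLabel-involutive (block t s) = cong (block t) (not-involutive s)

  negLabel-injective : ∀ {a b} → negLabel a ≡ negLabel b → a ≡ b
  negLabel-injective {a} {b} e =
    trans (sym (negLabel-involutive a)) (trans (cong negLabel e) (negLabel-involutive b))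

  negLabel-fixed : ∀ {a} → a ≡ negLabel a → a ≡ zeroBlock
  negLabel-fixed {zeroBlock} _ = refl
  negLabel-fixed {block t true} ()
  negLabel-fixed {block t false} ()

  ≈ᴸ-negLabel : ∀ a b → negLabel a ≈ᴸ negLabel b ≡ a ≈ᴸ b
  ≈ᴸ-negLabel a b =
    does-⇔ (mk⇔ negLabel-injective (cong negLabel)) (negLabel a ≟ᴸ negLabel b) (a ≟ᴸ b)

  ≈ᴸ-self-negLabel : ∀ a → a ≈ᴸ negLabel a ≡ zeroBlock ≈ᴸ a
  ≈ᴸ-self-negLabel a =
    does-⇔ (mk⇔ (λ e → sym (negLabel-fixed e)) (λ { refl → refl })) (a ≟ᴸ negLabel a) (zeroBlock ≟ᴸ a)

  -- What the next element does when k block pairs are open: open pair number k on its positive side,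
  -- join the zero block, or join side s of pair t.
  data Step (k : ℕ) : ℕ → Set where
    fresh : Step k (suc k)
    joinZero : Step k k
    join : Fin k → Bool → Step k k

  data Code : ℕ → ℕ → Set where
    [] : Code 0 0
    _▷_ : ∀ {n k k′} → Code n k → Step k k′ → Code (suc n) k′

  stepLabel : ∀ {k k′} → Step k k′ → Label
  stepLabel {k} fresh = block k true
  stepLabel joinZero = zeroBlock
  stepLabel (join t s) = block (toℕ t) s

  -- label c i is the label of the element i + 1; indices ≥ n get the junk value zeroBlock.
  label : ∀ {n k} → Code n k → ℕ → Label
  label [] i = zeroBlock
  label (_▷_ {n} c h) i = if i ≡ᵇ n then stepLabel h else label c i

  label-new : ∀ {n k k′} (c : Code n k) (h : Step k k′) →
    label (c ▷ h) (toℕ (fromℕ n)) ≡ stepLabel h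
  label-new {n} c h rewrite toℕ-fromℕ n | T⇒≡true (≡⇒≡ᵇ n n refl) = refl

  label-old : ∀ {n k k′} (c : Code n k) (h : Step k k′) (j : Fin n) →
    label (c ▷ h) (toℕ (inject₁ j)) ≡ label c (toℕ j)
  label-old c h j rewrite toℕ-inject₁ j | ≡ᵇ-false (λ e → <-irrefl e (toℕ<n j)) = refl

  step-≤ : ∀ {k k′} → Step k k′ → k ≤ k′
  step-≤ fresh = n≤1+n _
  step-≤ joinZero = ≤-refl
  step-≤ (join _ _) = ≤-refl

  pairs≤length : ∀ {n k} → Code n k → k ≤ n
  pairs≤length [] = z≤n
  pairs≤length (c ▷ fresh) = s≤s (pairs≤length c)
  pairs≤length (c ▷ joinZero) = m≤n⇒m≤1+n (pairs≤length c)
  pairs≤length (c ▷ join _ _) = m≤n⇒m≤1+n (pairs≤length c)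

  stepLabel-block< : ∀ {k k′ t s} (h : Step k k′) → stepLabel h ≡ block t s → t < k′
  stepLabel-block< fresh refl = ≤-refl
  stepLabel-block< (join u _) refl = toℕ<n u

  label-block< : ∀ {n k t s} (c : Code n k) i → label c i ≡ block t s → t < k
  label-block< (_▷_ {n} c h) i e with i ≡ᵇ n
  ... | true = stepLabel-block< h e
  ... | false = ≤-trans (label-block< c i e) (step-≤ h)

  opener : ∀ {n k} (c : Code n k) (t : Fin k) →
    Σ (Fin n) λ i → label c (toℕ i) ≡ block (toℕ t) true
  opener (_▷_ {n} c fresh) t with lastView t
  ... | isLast = fromℕ n , trans (label-new c fresh) (cong block⁺ (sym (toℕ-fromℕ _)))
  ... | isInject t′ with opener c t′
  ...   | i , e = inject₁ i , trans (label-old c fresh i)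
                                      (trans e (cong block⁺ (sym (toℕ-inject₁ t′))))
  opener (c ▷ joinZero) t with opener c t
  ... | i , e = inject₁ i , trans (label-old c joinZero i) e
  opener (c ▷ join u s) t with opener c t
  ... | i , e = inject₁ i , trans (label-old c (join u s) i) e

  labelOf : ∀ {n k} → Code n k → Pt n → Label
  labelOf {n} c x with splitAt n x
  ... | inj₁ i = label c (toℕ i)
  ... | inj₂ i = negLabel (label c (toℕ i))

  labelOf-pos : ∀ {n k} (c : Code n k) (i : Fin n) → labelOf c (pos i) ≡ label c (toℕ i)
  labelOf-pos {n} c i rewrite splitAt-↑ˡ n i n = refl

  labelOf-neg : ∀ {n k} (c : Code n k) (i : Fin n) → labelOf c (negP i) ≡ negLabel (label c (toℕ i))
  labelOf-neg {n} c i rewrite splitAt-↑ʳ n n i = refl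

  labelOf-negate : ∀ {n k} (c : Code n k) (x : Pt n) → labelOf c (negate {n} x) ≡ negLabel (labelOf c x)
  labelOf-negate {n} c x with ptView {n} x
  ... | isPos i = trans (cong (labelOf c) (negate-pos {n} i))
                    (trans (labelOf-neg c i) (cong negLabel (sym (labelOf-pos c i))))
  ... | isNeg i = trans (cong (labelOf c) (negate-neg {n} i))
                    (trans (labelOf-pos c i)
                      (trans (sym (negLabel-involutive _)) (cong negLabel (sym (labelOf-neg c i)))))

  labelOf-embed : ∀ {n k k′} (c : Code n k) (h : Step k k′) (x : Pt n) →
    labelOf (c ▷ h) (embed x) ≡ labelOf c x
  labelOf-embed {n} c h x with ptView {n} x
  ... | isPos i = trans (cong (labelOf (c ▷ h)) (embed-pos i))
                    (trans (labelOf-pos (c ▷ h) _) (trans (label-old c h i) (sym (labelOf-pos c i))))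
  ... | isNeg i = trans (cong (labelOf (c ▷ h)) (embed-neg i))
                    (trans (labelOf-neg (c ▷ h) _)
                      (trans (cong negLabel (label-old c h i)) (sym (labelOf-neg c i))))

  labelOf-new⁺ : ∀ {n k k′} (c : Code n k) (h : Step k k′) → labelOf (c ▷ h) (new⁺ n) ≡ stepLabel h
  labelOf-new⁺ c h = trans (labelOf-pos (c ▷ h) _) (label-new c h)

  labelOf-new⁻ : ∀ {n k k′} (c : Code n k) (h : Step k k′) →
    labelOf (c ▷ h) (new⁻ n) ≡ negLabel (stepLabel h)
  labelOf-new⁻ c h = trans (labelOf-neg (c ▷ h) _) (cong negLabel (label-new c h))

  labelOf-block< : ∀ {n k t s} (c : Code n k) x → labelOf c x ≡ block t s → t < k
  labelOf-block< {n} c x e with ptView {n} x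
  ... | isPos i = label-block< c (toℕ i) (trans (sym (labelOf-pos c i)) e)
  ... | isNeg i with label c (toℕ i) in eᵢ | trans (sym (labelOf-neg c i)) e
  ...   | block t′ s′ | refl = label-block< c (toℕ i) eᵢ

  block-witness : ∀ {n k} (c : Code n k) (t : Fin k) (s : Bool) →
    Σ (Pt n) λ x → labelOf c x ≡ block (toℕ t) s
  block-witness c t true with opener c t
  ... | i , e = pos i , trans (labelOf-pos c i) e
  block-witness c t false with opener c t
  ... | i , e = negP i , trans (labelOf-neg c i) (cong negLabel e)

  relOf : ∀ {n k} → Code n k → Rel n
  relOf c x y = labelOf c x ≈ᴸ labelOf c y

  relOf-sound : ∀ {n k} (c : Code n k) x y → relOf c x y ≡ true → labelOf c x ≡ labelOf c y
  relOf-sound c x y = ≈ᴸ-sound (labelOf c x) (labelOf c y)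

  relOf-complete : ∀ {n k} (c : Code n k) x y → labelOf c x ≡ labelOf c y → relOf c x y ≡ true
  relOf-complete c x y = ≈ᴸ-complete (labelOf c x) (labelOf c y)

  relOf-self-negate : ∀ {n k} (c : Code n k) x → relOf c x (negate {n} x) ≡ zeroBlock ≈ᴸ labelOf c x
  relOf-self-negate c x =
    trans (cong (labelOf c x ≈ᴸ_) (labelOf-negate c x)) (≈ᴸ-self-negLabel (labelOf c x))

  relOf-new⁺-new⁻ : ∀ {m k k′} (p : Code m k) (h : Step k k′) →
    relOf (p ▷ h) (new⁺ m) (new⁻ m) ≡ zeroBlock ≈ᴸ stepLabel h
  relOf-new⁺-new⁻ p h =
    trans (cong₂ _≈ᴸ_ (labelOf-new⁺ p h) (labelOf-new⁻ p h)) (≈ᴸ-self-negLabel (stepLabel h))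

  relOf-new⁺-embed : ∀ {m k k′} (p : Code m k) (h : Step k k′) y →
    relOf (p ▷ h) (new⁺ m) (embed y) ≡ stepLabel h ≈ᴸ labelOf p y
  relOf-new⁺-embed p h y = cong₂ _≈ᴸ_ (labelOf-new⁺ p h) (labelOf-embed p h y)

  -- Every signed partition is labelled by a unique code

  _≗₂_ : {A : Set} → (A → A → Bool) → (A → A → Bool) → Set
  R ≗₂ S = ∀ x y → R x y ≡ S x y

  record IsSignedPartition (n : ℕ) (R : Rel n) : Set where
    field
      reflexive : ∀ x → R x x ≡ true
      symmetric : ∀ x y → R x y ≡ true → R y x ≡ true
      transitive : ∀ x y z → R x y ≡ true → R y z ≡ true → R x z ≡ true
      negate-closed : ∀ x y → R x y ≡ R (negate {n} x) (negate {n} y)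
      zeroBlock-unique : ∀ x y → R x (negate {n} x) ≡ true → R y (negate {n} y) ≡ true →
        R x y ≡ true

    symmetric-≡ : ∀ x y → R x y ≡ R y x
    symmetric-≡ x y = true-ext (symmetric x y) (symmetric y x)

  open IsSignedPartition

  isSignedPartition-sound : ∀ n R → isSignedPartition n R ≡ true → IsSignedPartition n R
  isSignedPartition-sound n R e = record
    { reflexive = allFin-elim N reflexiveᵇ
    ; symmetric = λ x y → ⇒ᵇ-elim (allFin₂-elim symmetricᵇ x y)
    ; transitive = λ x y z xy yz → ⇒ᵇ-elim (allFin-elim N (allFin₂-elim transitiveᵇ x y) z) (∧-intro xy yz)
    ; negate-closed = λ x y → not-xor-elim (allFin₂-elim negClosedᵇ x y)
    ; zeroBlock-unique = λ x y zx zy → ⇒ᵇ-elim (allFin₂-elim atMostOneZeroᵇ x y) (∧-intro zx zy)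
    }
    where
    N = n + n
    allFin₂-elim : ∀ {p : Pt n → Pt n → Bool} → allFin N (λ x → allFin N (p x)) ≡ true → ∀ x y → p x y ≡ true
    allFin₂-elim e x = allFin-elim N (allFin-elim N e x)
    equivalenceᵇ = ∧-elimˡ e
    reflexiveᵇ = ∧-elimˡ equivalenceᵇ
    symmetricᵇ = ∧-elimˡ (∧-elimʳ {allFin N (λ x → R x x)} equivalenceᵇ)
    transitiveᵇ = ∧-elimʳ {allFin N (λ x → allFin N (λ y → R x y ⇒ᵇ R y x))}
                          (∧-elimʳ {allFin N (λ x → R x x)} equivalenceᵇ)
    negClosedᵇ = ∧-elimˡ (∧-elimʳ {isEquivalence n R} e)
    atMostOneZeroᵇ = ∧-elimʳ {negClosed n R} (∧-elimʳ {isEquivalence n R} e)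

  isSignedPartition-complete : ∀ n R → IsSignedPartition n R → isSignedPartition n R ≡ true
  isSignedPartition-complete n R sp =
    ∧-intro (∧-intro (allFin-intro N (reflexive sp))
                     (∧-intro (allFin₂-intro (λ x y → ⇒ᵇ-intro (symmetric sp x y)))
                              (allFin₂-intro (λ x y → allFin-intro N (λ z →
                                 ⇒ᵇ-intro (λ h → transitive sp x y z (∧-elimˡ h) (∧-elimʳ {R x y} h)))))))
            (∧-intro (allFin₂-intro (λ x y → not-xor-intro (negate-closed sp x y)))
                     (allFin₂-intro (λ x y →
                        ⇒ᵇ-intro (λ h → zeroBlock-unique sp x y (∧-elimˡ h) (∧-elimʳ {R x (negate {n} x)} h)))))
    where
    N = n + n
    allFin₂-intro : ∀ {p : Pt n → Pt n → Bool} → (∀ x y → p x y ≡ true) → allFin N (λ x → allFin N (p x)) ≡ true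
    allFin₂-intro f = allFin-intro N (λ x → allFin-intro N (f x))

  relOf-isSignedPartition : ∀ {n k} (c : Code n k) → IsSignedPartition n (relOf c)
  relOf-isSignedPartition {n} c = record
    { reflexive = λ x → ≈ᴸ-refl (labelOf c x)
    ; symmetric = λ x y e → relOf-complete c y x (sym (relOf-sound c x y e))
    ; transitive = λ x y z e₁ e₂ →
        relOf-complete c x z (trans (relOf-sound c x y e₁) (relOf-sound c y z e₂))
    ; negate-closed = λ x y → sym (trans (cong₂ _≈ᴸ_ (labelOf-negate c x) (labelOf-negate c y))
                                         (≈ᴸ-negLabel (labelOf c x) (labelOf c y)))
    ; zeroBlock-unique = λ x y zx zy → relOf-complete c x y (trans (isZero x zx) (sym (isZero y zy)))
    }
    where
    isZero : ∀ x → relOf c x (negate {n} x) ≡ true → labelOf c x ≡ zeroBlock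
    isZero x e = sym (≈ᴸ-sound zeroBlock (labelOf c x) (trans (sym (relOf-self-negate c x)) e))

  restrict : ∀ {m} → Rel (suc m) → Rel m
  restrict R x y = R (embed x) (embed y)

  restrict-isSignedPartition : ∀ {m} (R : Rel (suc m)) → IsSignedPartition (suc m) R →
    IsSignedPartition m (restrict R)
  restrict-isSignedPartition {m} R sp = record
    { reflexive = λ x → reflexive sp (embed x)
    ; symmetric = λ x y → symmetric sp (embed x) (embed y)
    ; transitive = λ x y z → transitive sp (embed x) (embed y) (embed z)
    ; negate-closed = λ x y →
        trans (negate-closed sp (embed x) (embed y)) (cong₂ R (negate-embed x) (negate-embed y))
    ; zeroBlock-unique = λ x y zx zy →
        zeroBlock-unique sp (embed x) (embed y) (trans (cong (R (embed x)) (negate-embed x)) zx)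
                                                (trans (cong (R (embed y)) (negate-embed y)) zy)
    }

  restrict-relOf : ∀ {n k k′} (c : Code n k) (h : Step k k′) → restrict (relOf (c ▷ h)) ≗₂ relOf c
  restrict-relOf c h x y = cong₂ _≈ᴸ_ (labelOf-embed c h x) (labelOf-embed c h y)

  extension-determined : ∀ {m} (R S : Rel (suc m)) →
    IsSignedPartition (suc m) R → IsSignedPartition (suc m) S →
    restrict R ≗₂ restrict S →
    (∀ y → R (new⁺ m) (embed y) ≡ S (new⁺ m) (embed y)) →
    R (new⁺ m) (new⁻ m) ≡ S (new⁺ m) (new⁻ m) →
    R ≗₂ S
  extension-determined {m} R S spR spS old new⁺-old new⁺-new⁻ x y = agree (extView x) (extView y)
    where
    new⁻-via-new⁺ : ∀ (T : Rel (suc m)) → IsSignedPartition (suc m) T →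
      ∀ y → T (new⁻ m) (embed y) ≡ T (new⁺ m) (embed (negate {m} y))
    new⁻-via-new⁺ T sp y =
      trans (negate-closed sp (new⁻ m) (embed y)) (cong₂ T (negate-neg {suc m} _) (negate-embed y))
    new⁻-old : ∀ y → R (new⁻ m) (embed y) ≡ S (new⁻ m) (embed y)
    new⁻-old y =
      trans (new⁻-via-new⁺ R spR y) (trans (new⁺-old (negate {m} y)) (sym (new⁻-via-new⁺ S spS y)))
    flip : ∀ {x y} → R x y ≡ S x y → R y x ≡ S y x
    flip {x} {y} e = trans (symmetric-≡ spR y x) (trans e (symmetric-≡ spS x y))
    agree : ∀ {x y} → ExtView x → ExtView y → R x y ≡ S x y
    agree isNew⁺ isNew⁺ = trans (reflexive spR _) (sym (reflexive spS _))
    agree isNew⁺ isNew⁻ = new⁺-new⁻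
    agree isNew⁺ (isOld y) = new⁺-old y
    agree isNew⁻ isNew⁺ = flip new⁺-new⁻
    agree isNew⁻ isNew⁻ = trans (reflexive spR _) (sym (reflexive spS _))
    agree isNew⁻ (isOld y) = new⁻-old y
    agree (isOld x) isNew⁺ = flip (new⁺-old x)
    agree (isOld x) isNew⁻ = flip (new⁻-old x)
    agree (isOld x) (isOld y) = old x y

  module Extension {m k} (R : Rel (suc m)) (sp : IsSignedPartition (suc m) R)
                   (p : Code m k) (R≗p : restrict R ≗₂ relOf p) where

    extends : ∀ {k′} (h : Step k k′) →
      (∀ y → R (new⁺ m) (embed y) ≡ stepLabel h ≈ᴸ labelOf p y) →
      R (new⁺ m) (new⁻ m) ≡ zeroBlock ≈ᴸ stepLabel h →
      R ≗₂ relOf (p ▷ h)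
    extends h new-old new-new = extension-determined R (relOf (p ▷ h)) sp (relOf-isSignedPartition (p ▷ h))
      (λ x y → trans (R≗p x y) (sym (restrict-relOf p h x y)))
      (λ y → trans (new-old y) (sym (relOf-new⁺-embed p h y)))
      (trans new-new (sym (relOf-new⁺-new⁻ p h)))

    old-self-negate : ∀ y → R (embed y) (negate {suc m} (embed y)) ≡ zeroBlock ≈ᴸ labelOf p y
    old-self-negate y =
      trans (cong (R (embed y)) (negate-embed y)) (trans (R≗p y (negate {m} y)) (relOf-self-negate p y))

    new⁻-negate : ∀ y → R (new⁺ m) (embed y) ≡ R (new⁻ m) (negate {suc m} (embed y))
    new⁻-negate y = trans (negate-closed sp (new⁺ m) (embed y))
                          (cong (λ w → R w (negate {suc m} (embed y))) (negate-pos {suc m} _))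

    zero-via-new : R (new⁺ m) (new⁻ m) ≡ true → ∀ y →
      R (new⁺ m) (embed y) ≡ true → R (embed y) (negate {suc m} (embed y)) ≡ true
    zero-via-new z y h = transitive sp _ _ _ (symmetric sp _ _ h)
                           (transitive sp _ _ _ z (trans (sym (new⁻-negate y)) h))

    decode-joinZero : R (new⁺ m) (new⁻ m) ≡ true → R ≗₂ relOf (p ▷ joinZero)
    decode-joinZero z =
      extends joinZero (λ y → trans (true-ext (zero-via-new z y) (zero-new y)) (old-self-negate y)) z
      where
      zero-new : ∀ y → R (embed y) (negate {suc m} (embed y)) ≡ true → R (new⁺ m) (embed y) ≡ true
      zero-new y = zeroBlock-unique sp (new⁺ m) (embed y) (trans (cong (R _) (negate-pos {suc m} _)) z)

    decode-fresh : R (new⁺ m) (new⁻ m) ≡ false → (∀ y → R (new⁺ m) (embed y) ≡ false) →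
      R ≗₂ relOf (p ▷ fresh)
    decode-fresh z none = extends fresh (λ y → trans (none y) (sym (≈ᴸ-false _ _ (fresh≢old y)))) z
      where
      fresh≢old : ∀ y → block k true ≢ labelOf p y
      fresh≢old y eq = <-irrefl refl (labelOf-block< p y (sym eq))

    decode-join : R (new⁺ m) (new⁻ m) ≡ false → ∀ y₀ → R (new⁺ m) (embed y₀) ≡ true →
      Σ (Step k k) λ h → R ≗₂ relOf (p ▷ h)
    decode-join z y₀ r₀ with labelOf p y₀ in l₀
    ... | zeroBlock = ⊥-elim (false≢true z (transitive sp _ _ _ r₀ (transitive sp _ _ _ y₀-zero
                        (symmetric sp _ _ (trans (sym (new⁻-negate y₀)) r₀)))))
      where
      y₀-zero : R (embed y₀) (negate {suc m} (embed y₀)) ≡ true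
      y₀-zero = trans (old-self-negate y₀) (cong (zeroBlock ≈ᴸ_) l₀)
    ... | block t s = h , extends h new-old z
      where
      t<k = labelOf-block< p y₀ l₀
      h : Step k k
      h = join (fromℕ< t<k) s
      new-old : ∀ y → R (new⁺ m) (embed y) ≡ stepLabel h ≈ᴸ labelOf p y
      new-old y = begin
        R (new⁺ m) (embed y)         ≡⟨ true-ext (transitive sp _ _ _ (symmetric sp _ _ r₀))
                                                     (transitive sp _ _ _ r₀) ⟩
        R (embed y₀) (embed y)       ≡⟨ R≗p y₀ y ⟩
        labelOf p y₀ ≈ᴸ labelOf p y  ≡⟨ cong (_≈ᴸ labelOf p y)
                                             (trans l₀ (cong (λ u → block u s) (sym (toℕ-fromℕ< t<k)))) ⟩
        stepLabel h ≈ᴸ labelOf p y   ∎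

    decode-step : Σ ℕ λ k′ → Σ (Step k k′) λ h → R ≗₂ relOf (p ▷ h)
    decode-step with R (new⁺ m) (new⁻ m) in z
    ... | true = k , joinZero , decode-joinZero z
    ... | false with any? {m + m} (λ y → R (new⁺ m) (embed y) Bool.≟ true)
    ...   | yes (y₀ , r₀) = k , decode-join z y₀ r₀
    ...   | no none = suc k , fresh , decode-fresh z (λ y → ¬-not (λ e → none (y , e)))

  decode : ∀ n (R : Rel n) → IsSignedPartition n R →
    Σ ℕ λ k → Σ (Code n k) λ c → R ≗₂ relOf c
  decode zero R sp = 0 , [] , λ ()
  decode (suc m) R sp with decode m (restrict R) (restrict-isSignedPartition R sp)
  ... | k , p , R≗p with Extension.decode-step R sp p R≗p
  ...   | k′ , h , R≗ph = k′ , p ▷ h , R≗ph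

  fresh≢join : ∀ {k} (t : Fin k) s →
    block k true ≈ᴸ block (toℕ t) s ≢ block (toℕ t) s ≈ᴸ block (toℕ t) s
  fresh≢join {k} t s eq = false≢true (≈ᴸ-false _ _ different) (trans eq (≈ᴸ-refl (block (toℕ t) s)))
    where
    different : block k true ≢ block (toℕ t) s
    different e = <-irrefl (sym (proj₁ (block-injective e))) (toℕ<n t)

  step-injective : ∀ {k k₁ k₂} (h₁ : Step k k₁) (h₂ : Step k k₂) →
    zeroBlock ≈ᴸ stepLabel h₁ ≡ zeroBlock ≈ᴸ stepLabel h₂ →
    (∀ (t : Fin k) s → stepLabel h₁ ≈ᴸ block (toℕ t) s ≡ stepLabel h₂ ≈ᴸ block (toℕ t) s) →
    _≡_ {A = Σ ℕ (Step k)} (k₁ , h₁) (k₂ , h₂)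
  step-injective fresh fresh _ _ = refl
  step-injective joinZero joinZero _ _ = refl
  step-injective fresh (join t s) _ same = ⊥-elim (fresh≢join t s (same t s))
  step-injective (join t s) fresh _ same = ⊥-elim (fresh≢join t s (sym (same t s)))
  step-injective (join t s) (join t′ s′) _ same
    with block-injective (≈ᴸ-sound (block (toℕ t′) s′) (block (toℕ t) s)
                                    (trans (sym (same t s)) (≈ᴸ-refl (block (toℕ t) s))))
  ... | t′≡t , refl with toℕ-injective t′≡t
  ...   | refl = refl
  step-injective fresh joinZero () _
  step-injective joinZero fresh () _
  step-injective joinZero (join _ _) () _
  step-injective (join _ _) joinZero () _

  relOf-injective : ∀ n {k k′} (c : Code n k) (c′ : Code n k′) → relOf c ≗₂ relOf c′ →
    _≡_ {A = Σ ℕ (Code n)} (k , c) (k′ , c′)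
  relOf-injective zero [] [] _ = refl
  relOf-injective (suc m) (p ▷ h) (p′ ▷ h′) same
    with relOf-injective m p p′ (λ x y → trans (sym (restrict-relOf p h x y))
                                              (trans (same (embed x) (embed y)) (restrict-relOf p′ h′ x y)))
  ... | refl = cong (λ (k′ , h) → k′ , p ▷ h) (step-injective h h′ same-zero same-blocks)
    where
    same-zero : zeroBlock ≈ᴸ stepLabel h ≡ zeroBlock ≈ᴸ stepLabel h′
    same-zero = trans (sym (relOf-new⁺-new⁻ p h)) (trans (same (new⁺ m) (new⁻ m)) (relOf-new⁺-new⁻ p h′))
    same-blocks : ∀ t s → stepLabel h ≈ᴸ block (toℕ t) s ≡ stepLabel h′ ≈ᴸ block (toℕ t) s
    same-blocks t s with block-witness p t s
    ... | y , e = subst (λ l → stepLabel h ≈ᴸ l ≡ stepLabel h′ ≈ᴸ l) e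
                    (trans (sym (relOf-new⁺-embed p h y))
                           (trans (same (new⁺ m) (embed y)) (relOf-new⁺-embed p h′ y)))

  least-witness : ∀ N (q : Fin N → Bool) (w : Fin N) → q w ≡ true →
    Σ (Fin N) λ x → (q x ≡ true) × (∀ y → toℕ y < toℕ x → q y ≡ false)
  least-witness (suc N) q w qw with q zero in q0
  ... | true = zero , q0 , λ y ()
  ... | false with w
  ...   | zero = ⊥-elim (false≢true q0 qw)
  ...   | suc w′ with least-witness N (λ i → q (suc i)) w′ qw
  ...     | x , qx , least = suc x , qx , λ { zero _ → q0 ; (suc y) (s≤s y<x) → least y y<x }

  -- Pt k doubles as the set of the 2k non-zero labels available to a code with k block pairs.
  pointLabel : ∀ {k} → Pt k → Label
  pointLabel {k} w with splitAt k w
  ... | inj₁ i = block (toℕ i) true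
  ... | inj₂ i = block (toℕ i) false

  pointLabel-pos : ∀ {k} (i : Fin k) → pointLabel {k} (pos i) ≡ block (toℕ i) true
  pointLabel-pos {k} i rewrite splitAt-↑ˡ k i k = refl

  pointLabel-neg : ∀ {k} (i : Fin k) → pointLabel {k} (negP i) ≡ block (toℕ i) false
  pointLabel-neg {k} i rewrite splitAt-↑ʳ k k i = refl

  pointLabel-nonzero : ∀ {k} (w : Pt k) → pointLabel {k} w ≢ zeroBlock
  pointLabel-nonzero {k} w e with ptView {k} w
  ... | isPos i with () ← trans (sym (pointLabel-pos i)) e
  pointLabel-nonzero {k} w e | isNeg i with () ← trans (sym (pointLabel-neg i)) e

  pointLabel-injective : ∀ {k} (w w′ : Pt k) → pointLabel {k} w ≡ pointLabel {k} w′ → w ≡ w′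
  pointLabel-injective {k} w w′ e with ptView {k} w | ptView {k} w′
  ... | isPos i | isPos j = cong pos (toℕ-injective (proj₁ (block-injective
                              (trans (sym (pointLabel-pos i)) (trans e (pointLabel-pos j))))))
  ... | isNeg i | isNeg j = cong negP (toℕ-injective (proj₁ (block-injective
                              (trans (sym (pointLabel-neg i)) (trans e (pointLabel-neg j))))))
  ... | isPos i | isNeg j with () ← trans (sym (pointLabel-pos i)) (trans e (pointLabel-neg j))
  ... | isNeg i | isPos j with () ← trans (sym (pointLabel-neg i)) (trans e (pointLabel-pos j))

  pointLabel-onto : ∀ {k} (l : Label) → (∀ {t s} → l ≡ block t s → t < k) → l ≢ zeroBlock →
    Σ (Pt k) λ w → pointLabel {k} w ≡ l
  pointLabel-onto zeroBlock _ nonzero = ⊥-elim (nonzero refl)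
  pointLabel-onto (block t true) bound _ =
    pos (fromℕ< (bound refl)) , trans (pointLabel-pos _) (cong block⁺ (toℕ-fromℕ< _))
  pointLabel-onto {k} (block t false) bound _ =
    negP (fromℕ< (bound refl)) , trans (pointLabel-neg {k} _) (cong (λ u → block u false) (toℕ-fromℕ< _))

  module BlockCount {n k} (c : Code n k) where

    -- The least point of a non-zero block: exactly what nonZeroBlocks counts.
    leader : Pt n → Bool
    leader x =
      not (relOf c x (negate {n} x)) ∧ allFin (n + n) (λ y → (toℕ y <ᵇ toℕ x) ⇒ᵇ not (relOf c x y))

    leader-nonzero : ∀ x → leader x ≡ true → labelOf c x ≢ zeroBlock
    leader-nonzero x e z =
      false≢true (not-elim (∧-elimˡ e)) (trans (relOf-self-negate c x) (cong (zeroBlock ≈ᴸ_) z))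

    leader-least : ∀ x → leader x ≡ true → ∀ y → toℕ y < toℕ x → labelOf c x ≢ labelOf c y
    leader-least x e y y<x eq =
      false≢true (not-elim (⇒ᵇ-elim (allFin-elim (n + n) (∧-elimʳ {not (relOf c x (negate {n} x))} e) y)
                                      (T⇒≡true (<⇒<ᵇ y<x))))
                 (relOf-complete c x y eq)

    leader-intro : ∀ x → labelOf c x ≢ zeroBlock → (∀ y → toℕ y < toℕ x → labelOf c x ≢ labelOf c y) →
      leader x ≡ true
    leader-intro x nonzero least =
      ∧-intro (not-intro (trans (relOf-self-negate c x) (≈ᴸ-false _ _ (λ e → nonzero (sym e)))))
              (allFin-intro (n + n) (λ y → ⇒ᵇ-intro (λ y<ᵇx →
                not-intro (≈ᴸ-false _ _ (least y (<ᵇ⇒< _ _ (≡true⇒T y<ᵇx)))))))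

    leader-injective : ∀ x y → leader x ≡ true → leader y ≡ true → labelOf c x ≡ labelOf c y → x ≡ y
    leader-injective x y lx ly eq with <-cmp (toℕ x) (toℕ y)
    ... | tri< x<y _ _ = ⊥-elim (leader-least y ly x x<y (sym eq))
    ... | tri≈ _ x≡y _ = toℕ-injective x≡y
    ... | tri> _ _ y<x = ⊥-elim (leader-least x lx y y<x eq)

    blockOf : (x : Pt n) → leader x ≡ true → Σ (Pt k) λ w → pointLabel {k} w ≡ labelOf c x
    blockOf x lx = pointLabel-onto (labelOf c x) (labelOf-block< c x) (leader-nonzero x lx)

    leaders≤ : countFin (n + n) leader ≤ countFin (k + k) (λ _ → true)
    leaders≤ = countFin-≤-injection (n + n) (k + k) leader (λ _ → true)
      (λ x lx → proj₁ (blockOf x lx)) (λ _ _ → refl)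
      (λ x y lx ly e → leader-injective x y lx ly
        (trans (sym (proj₂ (blockOf x lx))) (trans (cong (pointLabel {k}) e) (proj₂ (blockOf y ly)))))

    witness : (w : Pt k) → Σ (Pt n) λ x → labelOf c x ≡ pointLabel {k} w
    witness w with ptView {k} w
    ... | isPos i = let (x , e) = block-witness c i true in x , trans e (sym (pointLabel-pos i))
    ... | isNeg i = let (x , e) = block-witness c i false in x , trans e (sym (pointLabel-neg i))

    leaderOf : (w : Pt k) → Σ (Pt n) λ x → (labelOf c x ≡ pointLabel {k} w) × (leader x ≡ true)
    leaderOf w with least-witness (n + n) (λ x → labelOf c x ≈ᴸ pointLabel {k} w) (proj₁ (witness w))
                      (≈ᴸ-complete _ _ (proj₂ (witness w)))
    ... | x , found , least =
      x , labelled , leader-intro x (λ z → pointLabel-nonzero w (trans (sym labelled) z))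
                       (λ y y<x eq → false≢true (least y y<x) (≈ᴸ-complete _ _ (trans (sym eq) labelled)))
      where
      labelled = ≈ᴸ-sound _ _ found

    ≤leaders : countFin (k + k) (λ _ → true) ≤ countFin (n + n) leader
    ≤leaders = countFin-≤-injection (k + k) (n + n) (λ _ → true) leader (λ w _ → proj₁ (leaderOf w))
      (λ w _ → proj₂ (proj₂ (leaderOf w)))
      (λ w w′ _ _ e → pointLabel-injective w w′
        (trans (sym (proj₁ (proj₂ (leaderOf w)))) (trans (cong (labelOf c) e) (proj₁ (proj₂ (leaderOf w′))))))

    nonZeroBlocks-relOf : nonZeroBlocks n (relOf c) ≡ k + k
    nonZeroBlocks-relOf = trans (≤-antisym leaders≤ ≤leaders) (countFin-true (k + k))

  -- The condition on 1, …, r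

  OpensFirst : ∀ {n k} → Code n k → ℕ → Set
  OpensFirst {n} c r = ∀ (i : Fin n) → toℕ i < r → label c (toℕ i) ≡ block (toℕ i) true

  opensFirst : ∀ {n k} → Code n k → ℕ → Bool
  opensFirst {n} c r = (r ≤ᵇ n) ∧ allFin n (λ i → (toℕ i <ᵇ r) ⇒ᵇ (label c (toℕ i) ≈ᴸ block (toℕ i) true))

  opensFirst-sound : ∀ {n k} (c : Code n k) r → opensFirst c r ≡ true → r ≤ n × OpensFirst c r
  opensFirst-sound {n} c r e =
    ≤ᵇ⇒≤ r n (≡true⇒T (∧-elimˡ e)) ,
    λ i i<r → ≈ᴸ-sound _ _ (⇒ᵇ-elim (allFin-elim n (∧-elimʳ {r ≤ᵇ n} e) i) (T⇒≡true (<⇒<ᵇ i<r)))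

  opensFirst-complete : ∀ {n k} (c : Code n k) r → r ≤ n → OpensFirst c r → opensFirst c r ≡ true
  opensFirst-complete {n} c r r≤n opens =
    ∧-intro (T⇒≡true (≤⇒≤ᵇ r≤n))
            (allFin-intro n (λ i → ⇒ᵇ-intro (λ i<ᵇr → ≈ᴸ-complete _ _ (opens i (<ᵇ⇒< _ _ (≡true⇒T i<ᵇr))))))

  OpensFirst-restrict : ∀ {m k k′} (p : Code m k) (h : Step k k′) r →
    OpensFirst (p ▷ h) r → OpensFirst p r
  OpensFirst-restrict p h r opens j j<r =
    trans (sym (label-old p h j))
          (trans (opens (inject₁ j) (subst (_< r) (sym (toℕ-inject₁ j)) j<r)) (cong block⁺ (toℕ-inject₁ j)))

  OpensFirst-extend : ∀ {m k k′} (p : Code m k) (h : Step k k′) r → r ≤ m →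
    OpensFirst p r → OpensFirst (p ▷ h) r
  OpensFirst-extend {m} p h r r≤m opens i i<r with lastView i
  ... | isLast = ⊥-elim (<-irrefl refl (≤-trans (subst (_< r) (toℕ-fromℕ m) i<r) r≤m))
  ... | isInject j = trans (label-old p h j)
                       (trans (opens j (subst (_< r) (toℕ-inject₁ j) i<r)) (cong block⁺ (sym (toℕ-inject₁ j))))

  opensFirst-▷ : ∀ {m k k′} (p : Code m k) (h : Step k k′) r → r ≤ m →
    opensFirst (p ▷ h) r ≡ opensFirst p r
  opensFirst-▷ {m} p h r r≤m = true-ext
    (λ e → opensFirst-complete p r r≤m (OpensFirst-restrict p h r (proj₂ (opensFirst-sound (p ▷ h) r e))))
    (λ e → opensFirst-complete (p ▷ h) r (m≤n⇒m≤1+n r≤m)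
             (OpensFirst-extend p h r r≤m (proj₂ (opensFirst-sound p r e))))

  last<1+ : ∀ m → toℕ (fromℕ m) < suc m
  last<1+ m = subst (_< suc m) (sym (toℕ-fromℕ m)) ≤-refl

  OpensFirst-blocks : ∀ {m k} (p : Code m k) → OpensFirst p m → k ≡ m
  OpensFirst-blocks {zero} p _ = n≤0⇒n≡0 (pairs≤length p)
  OpensFirst-blocks {suc m} p opens = ≤-antisym (pairs≤length p)
    (label-block< p _ (trans (opens (fromℕ m) (last<1+ m)) (cong block⁺ (toℕ-fromℕ m))))

  OpensFirst-new : ∀ {m k k′} (p : Code m k) (h : Step k k′) →
    OpensFirst (p ▷ h) (suc m) → stepLabel h ≡ block m true
  OpensFirst-new {m} p h opens =
    trans (sym (label-new p h)) (trans (opens (fromℕ m) (last<1+ m)) (cong block⁺ (toℕ-fromℕ m)))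

  OpensFirst-▷-new : ∀ {m k k′} (p : Code m k) (h : Step k k′) →
    OpensFirst p m → stepLabel h ≡ block m true → OpensFirst (p ▷ h) (suc m)
  OpensFirst-▷-new {m} p h opens new i i<1+m with lastView i
  ... | isLast = trans (label-new p h) (trans new (cong block⁺ (sym (toℕ-fromℕ m))))
  ... | isInject j =
    OpensFirst-extend p h m ≤-refl opens (inject₁ j) (subst (_< m) (sym (toℕ-inject₁ j)) (toℕ<n j))

  opensFirst-fresh : ∀ {m k} (p : Code m k) → opensFirst (p ▷ fresh) (suc m) ≡ opensFirst p m
  opensFirst-fresh {m} p = true-ext
    (λ e → opensFirst-complete p m ≤-refl (OpensFirst-restrict p fresh m (λ i i<m →
             proj₂ (opensFirst-sound (p ▷ fresh) (suc m) e) i (m≤n⇒m≤1+n i<m))))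
    (λ e → let opens = proj₂ (opensFirst-sound p m e) in
           opensFirst-complete (p ▷ fresh) (suc m) ≤-refl
             (OpensFirst-▷-new p fresh opens (cong block⁺ (OpensFirst-blocks p opens))))

  opensFirst-stay : ∀ {m k} (p : Code m k) (h : Step k k) → opensFirst (p ▷ h) (suc m) ≡ false
  opensFirst-stay {m} p h = ¬-not (λ e →
    <-irrefl refl (≤-trans (stepLabel-block< h (OpensFirst-new p h (proj₂ (opensFirst-sound (p ▷ h) (suc m) e))))
                           (pairs≤length p)))

  opensFirst-short : ∀ {n k} (c : Code n k) r → n < r → opensFirst c r ≡ false
  opensFirst-short {n} c r n<r = ¬-not (λ e → <-irrefl refl (≤-trans n<r (proj₁ (opensFirst-sound c r e))))

  RCondition : ∀ n → ℕ → Rel n → Set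
  RCondition n r R =
    (∀ (i : Fin n) → toℕ i < r → R (pos i) (negP i) ≡ false) ×
    (∀ (i j : Fin n) → toℕ i < r → toℕ j < r → toℕ i ≢ toℕ j →
       (R (pos i) (pos j) ≡ false) × (R (pos i) (negP j) ≡ false))

  rCondition-sound : ∀ n r R → rCondition n r R ≡ true → r ≤ n × RCondition n r R
  rCondition-sound n r R e =
    ≤ᵇ⇒≤ r n (≡true⇒T (∧-elimˡ e)) ,
    (λ i i<r → not-elim (⇒ᵇ-elim (allFin-elim n nonzeroᵇ i) (T⇒≡true (<⇒<ᵇ i<r)))) ,
    (λ i j i<r j<r i≢j →
      let apart = ⇒ᵇ-elim (allFin-elim n (allFin-elim n apartᵇ i) j)
                    (∧-intro (T⇒≡true (<⇒<ᵇ i<r)) (∧-intro (T⇒≡true (<⇒<ᵇ j<r)) (not-intro (≡ᵇ-false i≢j))))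
      in not-elim (∧-elimˡ apart) , not-elim (∧-elimʳ {not (R (pos i) (pos j))} apart))
    where
    nonzeroᵇ = ∧-elimˡ (∧-elimʳ {r ≤ᵇ n} e)
    apartᵇ = ∧-elimʳ {allFin n (λ i → (toℕ i <ᵇ r) ⇒ᵇ not (R (pos i) (negP i)))} (∧-elimʳ {r ≤ᵇ n} e)

  rCondition-complete : ∀ n r R → r ≤ n → RCondition n r R → rCondition n r R ≡ true
  rCondition-complete n r R r≤n (nonzero , apart) = ∧-intro (T⇒≡true (≤⇒≤ᵇ r≤n)) (∧-intro
    (allFin-intro n (λ i → ⇒ᵇ-intro (λ i<ᵇr → not-intro (nonzero i (<ᵇ⇒< _ _ (≡true⇒T i<ᵇr))))))
    (allFin-intro n (λ i → allFin-intro n (λ j → ⇒ᵇ-intro (λ h →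
       let i<r = <ᵇ⇒< _ _ (≡true⇒T (∧-elimˡ h))
           j<r = <ᵇ⇒< _ _ (≡true⇒T (∧-elimˡ (∧-elimʳ {toℕ i <ᵇ r} h)))
           i≢j = λ i≡j → false≢true (not-elim (∧-elimʳ {toℕ j <ᵇ r} (∧-elimʳ {toℕ i <ᵇ r} h)))
                                     (T⇒≡true (≡⇒≡ᵇ _ _ i≡j))
           (pp , pn) = apart i j i<r j<r i≢j
       in ∧-intro (not-intro pp) (not-intro pn))))))

  RCondition-≗₂ : ∀ {n r} {R S : Rel n} → R ≗₂ S → RCondition n r R → RCondition n r S
  RCondition-≗₂ R≗S (nonzero , apart) =
    (λ i i<r → trans (sym (R≗S _ _)) (nonzero i i<r)) ,
    (λ i j i<r j<r i≢j → let (pp , pn) = apart i j i<r j<r i≢j in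
                         trans (sym (R≗S _ _)) pp , trans (sym (R≗S _ _)) pn)

  RCondition-restrict : ∀ {m r} (R : Rel (suc m)) → RCondition (suc m) r R → RCondition m r (restrict R)
  RCondition-restrict {m} {r} R (nonzero , apart) =
    (λ i i<r → trans (cong₂ R (embed-pos i) (embed-neg i)) (nonzero (inject₁ i) (lift< i i<r))) ,
    (λ i j i<r j<r i≢j →
      let (pp , pn) = apart (inject₁ i) (inject₁ j) (lift< i i<r) (lift< j j<r)
                            (λ e → i≢j (trans (sym (toℕ-inject₁ i)) (trans e (toℕ-inject₁ j))))
      in trans (cong₂ R (embed-pos i) (embed-pos j)) pp , trans (cong₂ R (embed-pos i) (embed-neg j)) pn)
    where
    lift< : ∀ i → toℕ i < r → toℕ (inject₁ i) < r
    lift< i = subst (_< r) (sym (toℕ-inject₁ i))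

  RCondition-weaken : ∀ {n r r′} {R : Rel n} → r′ ≤ r → RCondition n r R → RCondition n r′ R
  RCondition-weaken r′≤r (nonzero , apart) =
    (λ i i<r′ → nonzero i (≤-trans i<r′ r′≤r)) ,
    (λ i j i<r′ j<r′ → apart i j (≤-trans i<r′ r′≤r) (≤-trans j<r′ r′≤r))

  OpensFirst⇒RCondition : ∀ {n k} (c : Code n k) r → OpensFirst c r → RCondition n r (relOf c)
  OpensFirst⇒RCondition {n} c r opens = nonzero , apart
    where
    nonzero : ∀ i → toℕ i < r → relOf c (pos i) (negP i) ≡ false
    nonzero i i<r rewrite labelOf-pos c i | labelOf-neg c i | opens i i<r =
      ≈ᴸ-false (block (toℕ i) true) (block (toℕ i) false) λ ()
    apart : ∀ i j → toℕ i < r → toℕ j < r → toℕ i ≢ toℕ j →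
      (relOf c (pos i) (pos j) ≡ false) × (relOf c (pos i) (negP j) ≡ false)
    apart i j i<r j<r i≢j
      rewrite labelOf-pos c i | labelOf-pos c j | labelOf-neg c j | opens i i<r | opens j j<r =
      ≈ᴸ-false (block (toℕ i) true) (block (toℕ j) true) (λ e → i≢j (proj₁ (block-injective e))) ,
      ≈ᴸ-false (block (toℕ i) true) (block (toℕ j) false) λ ()

  RCondition-relOf-restrict : ∀ {m k k′ r} (p : Code m k) (h : Step k k′) →
    RCondition (suc m) r (relOf (p ▷ h)) → RCondition m r (relOf p)
  RCondition-relOf-restrict p h cond =
    RCondition-≗₂ {R = restrict (relOf (p ▷ h))} (restrict-relOf p h) (RCondition-restrict (relOf (p ▷ h)) cond)

  RCondition-new-apart : ∀ {m} {R : Rel (suc m)} → RCondition (suc m) (suc m) R →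
    ∀ y → R (new⁺ m) (embed y) ≡ false
  RCondition-new-apart {m} {R} (_ , apart) y = separated (ptView {m} y)
    where
    apart-new : ∀ i → (R (new⁺ m) (pos (inject₁ i)) ≡ false) × (R (new⁺ m) (negP (inject₁ i)) ≡ false)
    apart-new i = apart (fromℕ m) (inject₁ i) (last<1+ m) (toℕ<n _) (λ e → fromℕ≢inject₁ (toℕ-injective e))
    separated : ∀ {y} → PtView {m} y → R (new⁺ m) (embed y) ≡ false
    separated (isPos i) = trans (cong (R (new⁺ m)) (embed-pos i)) (proj₁ (apart-new i))
    separated (isNeg i) = trans (cong (R (new⁺ m)) (embed-neg i)) (proj₂ (apart-new i))

  RCondition⇒OpensFirst : ∀ {n k} (c : Code n k) r → r ≤ n → RCondition n r (relOf c) → OpensFirst c r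
  RCondition⇒OpensFirst [] r _ _ ()
  RCondition⇒OpensFirst {suc m} (p ▷ h) r r≤1+m cond with m≤n⇒m<n∨m≡n r≤1+m
  ... | inj₁ (s≤s r≤m) =
    OpensFirst-extend p h r r≤m (RCondition⇒OpensFirst p r r≤m (RCondition-relOf-restrict p h cond))
  ... | inj₂ refl = OpensFirst-▷-new p h opens (new-opens h cond)
    where
    opens : OpensFirst p m
    opens = RCondition⇒OpensFirst p m ≤-refl
              (RCondition-relOf-restrict p h (RCondition-weaken {R = relOf (p ▷ h)} (n≤1+n m) cond))
    new-opens : ∀ {k′} (h : Step _ k′) → RCondition (suc m) (suc m) (relOf (p ▷ h)) → stepLabel h ≡ block m true
    new-opens fresh _ = cong block⁺ (OpensFirst-blocks p opens)
    new-opens joinZero (nonzero , _) =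
      ⊥-elim (false≢true (nonzero (fromℕ m) (last<1+ m)) (relOf-new⁺-new⁻ p joinZero))
    new-opens (join t s) cond with block-witness p t s
    ... | y , y-label = ⊥-elim (false≢true (RCondition-new-apart {R = relOf (p ▷ join t s)} cond y)
                          (trans (relOf-new⁺-embed p (join t s) y) (≈ᴸ-complete _ _ (sym y-label))))

  rCondition-relOf : ∀ {n k} (c : Code n k) r → rCondition n r (relOf c) ≡ opensFirst c r
  rCondition-relOf {n} c r = true-ext
    (λ e → let (r≤n , cond) = rCondition-sound n r (relOf c) e in
           opensFirst-complete c r r≤n (RCondition⇒OpensFirst c r r≤n cond))
    (λ e → let (r≤n , opens) = opensFirst-sound c r e in
           rCondition-complete n r (relOf c) r≤n (OpensFirst⇒RCondition c r opens))

  Coded : ℕ → Set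
  Coded n = Σ ℕ (Code n)

  parent : ∀ {m} → Coded (suc m) → Coded m
  parent (_ , _▷_ {k = k} p _) = k , p

  ∨-elim : ∀ {a b} → a ∨ b ≡ true → (a ≡ true) ⊎ (b ≡ true)
  ∨-elim {true} _ = inj₁ refl
  ∨-elim {false} e = inj₂ e

  ∨-introˡ : ∀ {a b} → a ≡ true → a ∨ b ≡ true
  ∨-introˡ refl = refl

  ∨-introʳ : ∀ {a b} → b ≡ true → a ∨ b ≡ true
  ∨-introʳ {true} _ = refl
  ∨-introʳ {false} e = e

  anyFin : ∀ k → (Fin k → Bool) → Bool
  anyFin zero g = false
  anyFin (suc k) g = g zero ∨ anyFin k (λ t → g (suc t))

  anyFin-elim : ∀ k {g : Fin k → Bool} → anyFin k g ≡ true → Σ (Fin k) λ t → g t ≡ true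
  anyFin-elim (suc k) {g} e with ∨-elim {g zero} e
  ... | inj₁ g0 = zero , g0
  ... | inj₂ rest = let (t , gt) = anyFin-elim k rest in suc t , gt

  anyFin-intro : ∀ k {g : Fin k → Bool} t → g t ≡ true → anyFin k g ≡ true
  anyFin-intro (suc k) zero e = ∨-introˡ e
  anyFin-intro (suc k) {g} (suc t) e = ∨-introʳ {g zero} (anyFin-intro k t e)

  anyChild : ∀ {m} → (Coded (suc m) → Bool) → Coded m → Bool
  anyChild H (k , p) =
    H (suc k , p ▷ fresh) ∨
    (H (k , p ▷ joinZero) ∨ anyFin k (λ t → H (k , p ▷ join t true) ∨ H (k , p ▷ join t false)))

  sumChildren : ∀ {m} → (Coded (suc m) → ℕ) → Coded m → ℕ
  sumChildren F (k , p) =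
    F (suc k , p ▷ fresh) +
    (F (k , p ▷ joinZero) + sum (λ t → F (k , p ▷ join t true) + F (k , p ▷ join t false)))

  anyCode : ∀ n → (Coded n → Bool) → Bool
  anyCode zero H = H (0 , [])
  anyCode (suc m) H = anyCode m (anyChild H)

  sumCodes : ∀ n → (Coded n → ℕ) → ℕ
  sumCodes zero F = F (0 , [])
  sumCodes (suc m) F = sumCodes m (sumChildren F)

  anyChild-elim : ∀ {m} (H : Coded (suc m) → Bool) c → anyChild H c ≡ true →
    Σ (Coded (suc m)) λ c′ → (H c′ ≡ true) × (parent c′ ≡ c)
  anyChild-elim H (k , p) e with ∨-elim {H (suc k , p ▷ fresh)} e
  ... | inj₁ hit = _ , hit , refl
  ... | inj₂ e′ with ∨-elim {H (k , p ▷ joinZero)} e′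
  ...   | inj₁ hit = _ , hit , refl
  ...   | inj₂ e″ with anyFin-elim k e″
  ...     | t , e‴ with ∨-elim {H (k , p ▷ join t true)} e‴
  ...       | inj₁ hit = _ , hit , refl
  ...       | inj₂ hit = _ , hit , refl

  anyChild-intro : ∀ {m} (H : Coded (suc m) → Bool) c → H c ≡ true → anyChild H (parent c) ≡ true
  anyChild-intro H (_ , p ▷ fresh) e = ∨-introˡ e
  anyChild-intro H (_ , p ▷ joinZero) e = ∨-introʳ {H (_ , p ▷ fresh)} (∨-introˡ e)
  anyChild-intro H (k , p ▷ join t true) e =
    ∨-introʳ {H (suc k , p ▷ fresh)} (∨-introʳ {H (k , p ▷ joinZero)} (anyFin-intro k t (∨-introˡ e)))
  anyChild-intro H (k , p ▷ join t false) e =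
    ∨-introʳ {H (suc k , p ▷ fresh)} (∨-introʳ {H (k , p ▷ joinZero)}
      (anyFin-intro k t (∨-introʳ {H (k , p ▷ join t true)} e)))

  anyCode-elim : ∀ n (H : Coded n → Bool) → anyCode n H ≡ true → Σ (Coded n) λ c → H c ≡ true
  anyCode-elim zero H e = _ , e
  anyCode-elim (suc m) H e =
    let (c , hit) = anyCode-elim m (anyChild H) e ; (c′ , hit′ , _) = anyChild-elim H c hit in c′ , hit′

  anyCode-intro : ∀ n (H : Coded n → Bool) c → H c ≡ true → anyCode n H ≡ true
  anyCode-intro zero H (.0 , []) e = e
  anyCode-intro (suc m) H c e = anyCode-intro m (anyChild H) (parent c) (anyChild-intro H c e)

  sumCodes-cong : ∀ n {F G : Coded n → ℕ} → (∀ c → F c ≡ G c) → sumCodes n F ≡ sumCodes n G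
  sumCodes-cong zero e = e _
  sumCodes-cong (suc m) e =
    sumCodes-cong m (λ (k , p) →
      cong₂ _+_ (e _) (cong₂ _+_ (e _) (sum-cong-≗ {k} (λ t → cong₂ _+_ (e _) (e _)))))

  sumCodes-zero : ∀ n {F : Coded n → ℕ} → (∀ c → F c ≡ 0) → sumCodes n F ≡ 0
  sumCodes-zero zero e = e _
  sumCodes-zero (suc m) e = sumCodes-zero m (λ (k , p) →
    cong₂ _+_ (e _) (cong₂ _+_ (e _)
      (trans (sum-cong-≗ {k} (λ t → cong₂ _+_ (e _) (e _))) (sum-replicate-zero k))))

  sumCodes-+ : ∀ n (F G : Coded n → ℕ) → sumCodes n (λ c → F c + G c) ≡ sumCodes n F + sumCodes n G
  sumCodes-+ zero F G = refl
  sumCodes-+ (suc m) F G = trans (sumCodes-cong m children-+) (sumCodes-+ m (sumChildren F) (sumChildren G))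
    where
    children-+ : ∀ c → sumChildren (λ c → F c + G c) c ≡ sumChildren F c + sumChildren G c
    children-+ (k , p) =
      trans (cong (λ u → F′ + G′ + (F₀ + G₀ + u))
                  (trans (sum-cong-≗ {k} (λ t → +-interchange (F (k , p ▷ join t true)) _ _ _))
                         (∑-distrib-+ {k} _ _)))
            (trans (cong ((F′ + G′) +_) (+-interchange F₀ G₀ _ _)) (+-interchange F′ G′ _ _))
      where
      F′ = F (suc k , p ▷ fresh)
      G′ = G (suc k , p ▷ fresh)
      F₀ = F (k , p ▷ joinZero)
      G₀ = G (k , p ▷ joinZero)

  sumCodes-* : ∀ n a (F : Coded n → ℕ) → sumCodes n (λ c → a * F c) ≡ a * sumCodes n F
  sumCodes-* zero a F = refl
  sumCodes-* (suc m) a F = trans (sumCodes-cong m children-*) (sumCodes-* m a (sumChildren F))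
    where
    children-* : ∀ c → sumChildren (λ c → a * F c) c ≡ a * sumChildren F c
    children-* (k , p) = begin
      a * F′ + (a * F₀ + sum (λ t → a * F (k , p ▷ join t true) + a * F (k , p ▷ join t false)))
        ≡⟨ cong (λ u → a * F′ + (a * F₀ + u))
             (trans (sum-cong-≗ {k} (λ t → sym (*-distribˡ-+ a (F (k , p ▷ join t true)) _)))
                    (sym (*-distribˡ-sum {k} a _))) ⟩
      a * F′ + (a * F₀ + a * sum (λ t → F (k , p ▷ join t true) + F (k , p ▷ join t false)))
        ≡⟨ cong (a * F′ +_) (*-distribˡ-+ a F₀ _) ⟨
      a * F′ + a * (F₀ + sum (λ t → F (k , p ▷ join t true) + F (k , p ▷ join t false)))
        ≡⟨ *-distribˡ-+ a F′ _ ⟨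
      a * sumChildren F (k , p) ∎
      where
      F′ = F (suc k , p ▷ fresh)
      F₀ = F (k , p ▷ joinZero)

  Disjoint : ∀ {A : Set} M → (A → (Fin M → Bool) → Bool) → Set
  Disjoint {A} M H = ∀ (a a′ : A) f → H a f ≡ true → H a′ f ≡ true → a ≡ a′

  countFun-anyFin : ∀ M k (G : Fin k → (Fin M → Bool) → Bool) → Disjoint M G →
    countFun M (λ f → anyFin k (λ t → G t f)) ≡ sum (λ t → countFun M (G t))
  countFun-anyFin M zero G _ = countFun-false M (λ f → refl)
  countFun-anyFin M (suc k) G disjoint =
    trans (countFun-∨ M (λ f g₀ rest → let (t , gt) = anyFin-elim k rest in 0≢1+n (disjoint zero (suc t) f g₀ gt)))
          (cong (countFun M (G zero) +_) (countFun-anyFin M k (λ t → G (suc t))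
            (λ a a′ f e e′ → suc-injective (disjoint (suc a) (suc a′) f e e′))))
    where
    0≢1+n : ∀ {t : Fin k} → _≢_ {A = Fin (suc k)} zero (suc t)
    0≢1+n ()

  countFun-anyCode : ∀ n M (H : Coded n → (Fin M → Bool) → Bool) → Disjoint M H →
    countFun M (λ f → anyCode n (λ c → H c f)) ≡ sumCodes n (λ c → countFun M (H c))
  countFun-anyCode zero M H _ = refl
  countFun-anyCode (suc m) M H disjoint =
    trans (countFun-anyCode m M (λ p f → anyChild (λ c → H c f) p) parents-disjoint)
          (sumCodes-cong m count-children)
    where
    parents-disjoint : Disjoint M (λ p f → anyChild (λ c → H c f) p)
    parents-disjoint p p′ f e e′ =
      let (c , hit , pc) = anyChild-elim (λ c → H c f) p e
          (c′ , hit′ , pc′) = anyChild-elim (λ c → H c f) p′ e′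
      in trans (sym pc) (trans (cong parent (disjoint c c′ f hit hit′)) pc′)

    count-children : ∀ c →
      countFun M (λ f → anyChild (λ c → H c f) c) ≡ sumChildren (λ c → countFun M (H c)) c
    count-children (k , p) =
      trans (countFun-∨ M fresh-apart)
        (cong (countFun M (H (suc k , p ▷ fresh)) +_)
          (trans (countFun-∨ M joinZero-apart)
            (cong (countFun M (H (k , p ▷ joinZero)) +_)
              (trans (countFun-anyFin M k joined joins-disjoint)
                 (sum-cong-≗ {k} (λ t →
                   countFun-∨ M (λ f e e′ → true≢false-sign (disjoint _ _ f e e′))))))))
      where
      joined : Fin k → (Fin M → Bool) → Bool
      joined t f = H (k , p ▷ join t true) f ∨ H (k , p ▷ join t false) f
      joined-elim : ∀ t f → joined t f ≡ true → Σ Bool λ s → H (k , p ▷ join t s) f ≡ true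
      joined-elim t f e with ∨-elim {H (k , p ▷ join t true) f} e
      ... | inj₁ hit = true , hit
      ... | inj₂ hit = false , hit
      true≢false-sign : ∀ {t} → _≢_ {A = Coded (suc m)} (k , p ▷ join t true) (k , p ▷ join t false)
      true≢false-sign ()
      joinZero≢join : ∀ {t s} → _≢_ {A = Coded (suc m)} (k , p ▷ joinZero) (k , p ▷ join t s)
      joinZero≢join ()
      fresh≢stay : ∀ {c : Code (suc m) k} → _≢_ {A = Coded (suc m)} (suc k , p ▷ fresh) (k , c)
      fresh≢stay e = 1+n≢n (cong proj₁ e)
      join-index : ∀ {t t′ s s′} →
        _≡_ {A = Coded (suc m)} (k , p ▷ join t s) (k , p ▷ join t′ s′) → t ≡ t′
      join-index refl = refl
      joins-disjoint : Disjoint M joined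
      joins-disjoint t t′ f e e′ =
        let (s , hit) = joined-elim t f e ; (s′ , hit′) = joined-elim t′ f e′
        in join-index (disjoint _ _ f hit hit′)
      joinZero-apart : ∀ f → H (k , p ▷ joinZero) f ≡ true → anyFin k (λ t → joined t f) ≡ true → ⊥
      joinZero-apart f e e′ =
        let (t , hit) = anyFin-elim k e′ ; (s , hit′) = joined-elim t f hit
        in joinZero≢join (disjoint _ _ f e hit′)
      fresh-apart : ∀ f → H (suc k , p ▷ fresh) f ≡ true →
        (H (k , p ▷ joinZero) f ∨ anyFin k (λ t → joined t f)) ≡ true → ⊥
      fresh-apart f e e′ with ∨-elim {H (k , p ▷ joinZero) f} e′
      ... | inj₁ hit = fresh≢stay (disjoint _ _ f e hit)
      ... | inj₂ rest = let (t , hit) = anyFin-elim k rest ; (s , hit′) = joined-elim t f hit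
                        in fresh≢stay (disjoint _ _ f e hit′)

  -- S^B as a sum over codes

  isSignedPartition-≗₂ : ∀ {n} {R S : Rel n} → R ≗₂ S → isSignedPartition n R ≡ isSignedPartition n S
  isSignedPartition-≗₂ {n} e =
    cong₂ _∧_ (cong₂ _∧_ (all₁ (λ x → e x x))
                         (cong₂ _∧_ (all₂ (λ x y → cong₂ _⇒ᵇ_ (e x y) (e y x)))
                                    (all₂ (λ x y → all₁ (λ z → cong₂ _⇒ᵇ_ (cong₂ _∧_ (e x y) (e y z)) (e x z))))))
              (cong₂ _∧_ (all₂ (λ x y → cong not (cong₂ _xor_ (e x y) (e (negate {n} x) (negate {n} y)))))
                         (all₂ (λ x y → cong₂ _⇒ᵇ_ (cong₂ _∧_ (e x (negate {n} x)) (e y (negate {n} y))) (e x y))))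
    where
    all₁ = allFin-cong (n + n)
    all₂ : ∀ {p q : Pt n → Pt n → Bool} → (∀ x y → p x y ≡ q x y) →
      allFin (n + n) (λ x → allFin (n + n) (p x)) ≡ allFin (n + n) (λ x → allFin (n + n) (q x))
    all₂ pq = all₁ (λ x → all₁ (pq x))

  nonZeroBlocks-≗₂ : ∀ {n} {R S : Rel n} → R ≗₂ S → nonZeroBlocks n R ≡ nonZeroBlocks n S
  nonZeroBlocks-≗₂ {n} e = countFin-cong (n + n) (λ x →
    cong₂ _∧_ (cong not (e _ _))
              (allFin-cong (n + n) (λ y → cong (λ b → (toℕ y <ᵇ toℕ x) ⇒ᵇ not b) (e x y))))

  rCondition-≗₂ : ∀ {n} r {R S : Rel n} → R ≗₂ S → rCondition n r R ≡ rCondition n r S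
  rCondition-≗₂ {n} r e = cong ((r ≤ᵇ n) ∧_) (cong₂ _∧_
    (allFin-cong n (λ i → cong (λ b → (toℕ i <ᵇ r) ⇒ᵇ not b) (e _ _)))
    (allFin-cong n (λ i → allFin-cong n (λ j → cong₂ (λ a b → _ ⇒ᵇ (not a ∧ not b)) (e _ _) (e _ _)))))

  hasPairs-≗₂ : ∀ {n} k {R S : Rel n} → R ≗₂ S → hasPairs n k R ≡ hasPairs n k S
  hasPairs-≗₂ {n} k e = cong (λ u → ⌊ ℤ.+ u ℤ.≟ ℤ.+ 2 ℤ.* k ⌋) (nonZeroBlocks-≗₂ {n} e)

  double≡2* : ∀ a → ℤ.+ (a + a) ≡ ℤ.+ 2 ℤ.* ℤ.+ a
  double≡2* a = trans (cong (λ u → ℤ.+ (a + u)) (sym (+-identityʳ a))) (ℤ.pos-* 2 a)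

  hasPairs-relOf : ∀ {n kc} (c : Code n kc) k → hasPairs n k (relOf c) ≡ does (k ℤ.≟ ℤ.+ kc)
  hasPairs-relOf {n} {kc} c k = begin
    hasPairs n k (relOf c)                                ≡⟨ isYes≗does _ ⟩
    does (ℤ.+ nonZeroBlocks n (relOf c) ℤ.≟ ℤ.+ 2 ℤ.* k)  ≡⟨ cong (λ u → does (ℤ.+ u ℤ.≟ ℤ.+ 2 ℤ.* k))
                                                                (BlockCount.nonZeroBlocks-relOf c) ⟩
    does (ℤ.+ (kc + kc) ℤ.≟ ℤ.+ 2 ℤ.* k)                  ≡⟨ does-⇔ (mk⇔ halve double)
                                                                 (ℤ.+ (kc + kc) ℤ.≟ ℤ.+ 2 ℤ.* k) (k ℤ.≟ ℤ.+ kc) ⟩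
    does (k ℤ.≟ ℤ.+ kc)                                   ∎
    where
    halve : ℤ.+ (kc + kc) ≡ ℤ.+ 2 ℤ.* k → k ≡ ℤ.+ kc
    halve e = ℤ.*-cancelˡ-≡ (ℤ.+ 2) k (ℤ.+ kc) (trans (sym e) (double≡2* kc))
    double : k ≡ ℤ.+ kc → ℤ.+ (kc + kc) ≡ ℤ.+ 2 ℤ.* k
    double refl = double≡2* kc

  weight : ℤ → ℕ → ∀ {n} → Coded n → ℕ
  weight k r (kc , c) = indicator (does (k ℤ.≟ ℤ.+ kc) ∧ opensFirst c r)

  module Enumeration (n : ℕ) (k : ℤ) (r : ℕ) where

    M = (n + n) * (n + n)

    table : Coded n → Fin M → Bool
    table (_ , c) t = relOf c (proj₁ (remQuot {n + n} (n + n) t)) (proj₂ (remQuot {n + n} (n + n) t))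

    admissible : Rel n → Bool
    admissible R = hasPairs n k R ∧ rCondition n r R

    admissible-≗₂ : ∀ {R S : Rel n} → R ≗₂ S → admissible R ≡ admissible S
    admissible-≗₂ R≗S = cong₂ _∧_ (hasPairs-≗₂ {n} k R≗S) (rCondition-≗₂ {n} r R≗S)

    admissible-relOf : ∀ {kc} (c : Code n kc) → admissible (relOf c) ≡ does (k ℤ.≟ ℤ.+ kc) ∧ opensFirst c r
    admissible-relOf c = cong₂ _∧_ (hasPairs-relOf c k) (rCondition-relOf c r)

    counted : (Fin M → Bool) → Bool
    counted f = isSignedPartition n (toRel n f) ∧ admissible (toRel n f)

    matches : Coded n → (Fin M → Bool) → Bool
    matches c f = (f ≡ᶠ table c) ∧ admissible (relOf (proj₂ c))

    table-sound : ∀ f c → f ≡ᶠ table c ≡ true → toRel n f ≗₂ relOf (proj₂ c)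
    table-sound f (kc , c) e x y = trans (≡ᶠ-elim f (table (kc , c)) e (combine x y))
                                         (cong (λ (x′ , y′) → relOf c x′ y′) (remQuot-combine x y))

    table-complete : ∀ f c → toRel n f ≗₂ relOf (proj₂ c) → f ≡ᶠ table c ≡ true
    table-complete f (kc , c) e = ≡ᶠ-intro f (table (kc , c)) (λ t →
      trans (cong f (sym (combine-remQuot {n + n} (n + n) t)))
            (e (proj₁ (remQuot {n + n} (n + n) t)) (proj₂ (remQuot {n + n} (n + n) t))))

    counted⇔matched : ∀ f → counted f ≡ anyCode n (λ c → matches c f)
    counted⇔matched f = true-ext counted⇒matched matched⇒counted
      where
      counted⇒matched : counted f ≡ true → anyCode n (λ c → matches c f) ≡ true
      counted⇒matched e with decode n (toRel n f) (isSignedPartition-sound n _ (∧-elimˡ e))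
      ... | kc , c , R≗c = anyCode-intro n (λ c → matches c f) (kc , c)
        (∧-intro (table-complete f (kc , c) R≗c)
                 (trans (sym (admissible-≗₂ R≗c)) (∧-elimʳ {isSignedPartition n (toRel n f)} e)))
      matched⇒counted : anyCode n (λ c → matches c f) ≡ true → counted f ≡ true
      matched⇒counted e with anyCode-elim n (λ c → matches c f) e
      ... | (kc , c) , hit = ∧-intro
        (trans (isSignedPartition-≗₂ {n} R≗c) (isSignedPartition-complete n _ (relOf-isSignedPartition c)))
        (trans (admissible-≗₂ R≗c) (∧-elimʳ {f ≡ᶠ table (kc , c)} hit))
        where
        R≗c = table-sound f (kc , c) (∧-elimˡ hit)

    matches-disjoint : Disjoint M matches
    matches-disjoint (kc , c) (kc′ , c′) f e e′ = relOf-injective n c c′ (λ x y →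
      trans (sym (table-sound f (kc , c) (∧-elimˡ e) x y)) (table-sound f (kc′ , c′) (∧-elimˡ e′) x y))

    SB≡sumCodes : SB n k r ≡ sumCodes n (weight k r)
    SB≡sumCodes = begin
      SB n k r                                          ≡⟨ countFun-cong M counted⇔matched ⟩
      countFun M (λ f → anyCode n (λ c → matches c f))  ≡⟨ countFun-anyCode n M matches matches-disjoint ⟩
      sumCodes n (λ c → countFun M (matches c))         ≡⟨ sumCodes-cong n (λ (kc , c) →
                                                             trans (countFun-singleton M (table (kc , c)) _)
                                                                   (cong indicator (admissible-relOf c))) ⟩
      sumCodes n (weight k r)                           ∎

  pred-≟ : ∀ k a → does (k ℤ.≟ ℤ.+ suc a) ≡ does (k ℤ.- ℤ.+ 1 ℤ.≟ ℤ.+ a)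
  pred-≟ k a = does-⇔ (mk⇔ (λ { refl → refl }) (unpred k)) (k ℤ.≟ ℤ.+ suc a) (k ℤ.- ℤ.+ 1 ℤ.≟ ℤ.+ a)
    where
    unpred : ∀ k → k ℤ.- ℤ.+ 1 ≡ ℤ.+ a → k ≡ ℤ.+ suc a
    unpred (ℤ.+ suc j) refl = refl
    unpred (ℤ.+ zero) ()
    unpred ℤ.-[1+ j ] ()

  sum-const : ∀ k c → sum {k} (λ _ → c) ≡ k * c
  sum-const zero c = refl
  sum-const (suc k) c = cong (c +_) (sum-const k c)

  weight-fresh : ∀ {m kp} k r r′ (p : Code m kp) → opensFirst (p ▷ fresh) r ≡ opensFirst p r′ →
    weight k r (suc kp , p ▷ fresh) ≡ weight (k ℤ.- ℤ.+ 1) r′ (kp , p)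
  weight-fresh {kp = kp} k r r′ p opens = cong indicator (cong₂ _∧_ (pred-≟ k kp) opens)

  weight-stay : ∀ {m kp} k r r′ (p : Code m kp) (h : Step kp kp) → opensFirst (p ▷ h) r ≡ opensFirst p r′ →
    weight k r (kp , p ▷ h) ≡ weight k r′ (kp , p)
  weight-stay {kp = kp} k r r′ p h opens = cong indicator (cong (does (k ℤ.≟ ℤ.+ kp) ∧_) opens)

  weight-stay-full : ∀ {m kp} k (p : Code m kp) (h : Step kp kp) → weight k (suc m) (kp , p ▷ h) ≡ 0
  weight-stay-full {kp = kp} k p h =
    cong indicator (trans (cong (does (k ℤ.≟ ℤ.+ kp) ∧_) (opensFirst-stay p h)) (∧-zeroʳ _))

  SB-short : ∀ {n r} k → n < r → SB n k r ≡ 0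
  SB-short {n} {r} k n<r = trans (Enumeration.SB≡sumCodes n k r) (sumCodes-zero n (λ (kc , c) →
    cong indicator (trans (cong (does (k ℤ.≟ ℤ.+ kc) ∧_) (opensFirst-short c r n<r)) (∧-zeroʳ _))))

  sumCodes-diagonal : ∀ n k → sumCodes n (weight k n) ≡ δ k (ℤ.+ n)
  sumCodes-diagonal zero k = cong indicator (trans (∧-identityʳ _) (sym (isYes≗does _)))
  sumCodes-diagonal (suc m) k = begin
    sumCodes m (sumChildren (weight k (suc m)))  ≡⟨ sumCodes-cong m only-fresh ⟩
    sumCodes m (weight (k ℤ.- ℤ.+ 1) m)          ≡⟨ sumCodes-diagonal m (k ℤ.- ℤ.+ 1) ⟩
    δ (k ℤ.- ℤ.+ 1) (ℤ.+ m)                      ≡⟨ cong indicator shift ⟩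
    δ k (ℤ.+ suc m)                              ∎
    where
    only-fresh : ∀ c → sumChildren (weight k (suc m)) c ≡ weight (k ℤ.- ℤ.+ 1) m c
    only-fresh (kp , p) = trans
      (cong₂ _+_ (weight-fresh k (suc m) m p (opensFirst-fresh p))
                 (cong₂ _+_ (weight-stay-full k p joinZero)
                            (trans (sum-cong-≗ {kp} (λ t → cong₂ _+_ (weight-stay-full k p (join t true))
                                                                     (weight-stay-full k p (join t false))))
                                   (sum-replicate-zero kp))))
      (+-identityʳ _)
    shift : ⌊ k ℤ.- ℤ.+ 1 ℤ.≟ ℤ.+ m ⌋ ≡ ⌊ k ℤ.≟ ℤ.+ suc m ⌋
    shift = trans (isYes≗does _) (trans (sym (pred-≟ k m)) (sym (isYes≗does _)))

  SB-diagonal : ∀ r k → SB r k r ≡ δ k (ℤ.+ r)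
  SB-diagonal r k = trans (Enumeration.SB≡sumCodes r k r) (sumCodes-diagonal r k)

  SB-negative : ∀ n j r → SB n ℤ.-[1+ j ] r ≡ 0
  SB-negative n j r = trans (Enumeration.SB≡sumCodes n ℤ.-[1+ j ] r) (sumCodes-zero n (λ (kc , c) →
    cong indicator (cong (_∧ opensFirst c r) (dec-false (ℤ.-[1+ j ] ℤ.≟ ℤ.+ kc) λ ()))))

  stay-weights : ∀ j kp b → (b ≡ true → kp ≡ j) →
    indicator b + sum {kp} (λ _ → indicator b + indicator b) ≡ suc (j + j) * indicator b
  stay-weights j kp true same with same refl
  ... | refl = cong suc (begin
    sum {j} (λ _ → 2)  ≡⟨ sum-const j 2 ⟩
    j * 2              ≡⟨ *-comm j 2 ⟩
    j + (j + 0)        ≡⟨ cong (j +_) (+-identityʳ j) ⟩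
    j + j              ≡⟨ *-identityʳ (j + j) ⟨
    (j + j) * 1        ∎)
  stay-weights j kp false _ = trans (sum-replicate-zero kp) (sym (*-zeroʳ (suc (j + j))))

  children-step : ∀ {m r} j → r ≤ m → ∀ (c : Coded m) →
    sumChildren (weight (ℤ.+ j) r) c ≡ weight (ℤ.+ j ℤ.- ℤ.+ 1) r c + suc (j + j) * weight (ℤ.+ j) r c
  children-step {m} {r} j r≤m (kp , p) = cong₂ _+_
    (weight-fresh (ℤ.+ j) r r p (opensFirst-▷ p fresh r r≤m))
    (trans (cong₂ _+_ (stay joinZero)
                      (sum-cong-≗ {kp} (λ t → cong₂ _+_ (stay (join t true)) (stay (join t false)))))
           (stay-weights j kp (does (ℤ.+ j ℤ.≟ ℤ.+ kp) ∧ opensFirst p r)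
                         (λ e → sym (ℤ.+-injective (does-sound (ℤ.+ j ℤ.≟ ℤ.+ kp) (∧-elimˡ e))))))
    where
    stay : (h : Step kp kp) → weight (ℤ.+ j) r (kp , p ▷ h) ≡ weight (ℤ.+ j) r (kp , p)
    stay h = weight-stay (ℤ.+ j) r r p h (opensFirst-▷ p h r r≤m)

  SB-step : ∀ {m r} j → r ≤ m →
    SB (suc m) (ℤ.+ j) r ≡ SB m (ℤ.+ j ℤ.- ℤ.+ 1) r + suc (j + j) * SB m (ℤ.+ j) r
  SB-step {m} {r} j r≤m = begin
    SB (suc m) (ℤ.+ j) r
      ≡⟨ Enumeration.SB≡sumCodes (suc m) (ℤ.+ j) r ⟩
    sumCodes m (sumChildren (weight (ℤ.+ j) r))
      ≡⟨ sumCodes-cong m (children-step j r≤m) ⟩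
    sumCodes m (λ c → weight (ℤ.+ j ℤ.- ℤ.+ 1) r c + suc (j + j) * weight (ℤ.+ j) r c)
      ≡⟨ sumCodes-+ m _ _ ⟩
    sumCodes m (weight (ℤ.+ j ℤ.- ℤ.+ 1) r) + sumCodes m (λ c → suc (j + j) * weight (ℤ.+ j) r c)
      ≡⟨ cong (sumCodes m (weight (ℤ.+ j ℤ.- ℤ.+ 1) r) +_) (sumCodes-* m (suc (j + j)) _) ⟩
    sumCodes m (weight (ℤ.+ j ℤ.- ℤ.+ 1) r) + suc (j + j) * sumCodes m (weight (ℤ.+ j) r)
      ≡⟨ cong₂ (λ a b → a + suc (j + j) * b) (Enumeration.SB≡sumCodes m (ℤ.+ j ℤ.- ℤ.+ 1) r)
                                             (Enumeration.SB≡sumCodes m (ℤ.+ j) r) ⟨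
    SB m (ℤ.+ j ℤ.- ℤ.+ 1) r + suc (j + j) * SB m (ℤ.+ j) r
      ∎

open SignedPartitionCodes using (double≡2*; SB-short; SB-diagonal; SB-negative; SB-step)

open import Data.Nat using (ℕ; suc; _<_; _≤_; _∸_; s≤s)
import Data.Nat as ℕ
import Data.Nat.Properties as ℕ
open import Data.Integer using (ℤ; +_; -[1+_]; _+_; _-_; _*_)
import Data.Integer.Properties as ℤ
open import Data.Product using (_×_; _,_)
open import Relation.Binary.PropositionalEquality using (_≡_; refl; cong; cong₂; sym; trans; module ≡-Reasoning)
open ≡-Reasoning

suc-double≡2*+1 : ∀ j → + suc (j ℕ.+ j) ≡ + 2 * + j + + 1
suc-double≡2*+1 j = begin
  + suc (j ℕ.+ j)    ≡⟨ cong +_ (ℕ.+-comm 1 (j ℕ.+ j)) ⟩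
  + (j ℕ.+ j ℕ.+ 1)  ≡⟨ ℤ.pos-+ (j ℕ.+ j) 1 ⟩
  + (j ℕ.+ j) + + 1  ≡⟨ cong (_+ + 1) (double≡2* j) ⟩
  + 2 * + j + + 1    ∎

SB-recurrence : ∀ {r m} k → r ≤ m → + SB (suc m) k r ≡ + SB m (k - + 1) r + ((+ 2) * k + + 1) * + SB m k r
SB-recurrence {r} {m} (+ j) r≤m = begin
  + SB (suc m) (+ j) r                     ≡⟨ cong +_ (SB-step j r≤m) ⟩
  + (A ℕ.+ suc (j ℕ.+ j) ℕ.* B)            ≡⟨ ℤ.pos-+ A _ ⟩
  + A + + (suc (j ℕ.+ j) ℕ.* B)            ≡⟨ cong (λ x → + A + x) (ℤ.pos-* (suc (j ℕ.+ j)) B) ⟩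
  + A + + suc (j ℕ.+ j) * + B              ≡⟨ cong (λ x → + A + x * + B) (suc-double≡2*+1 j) ⟩
  + A + ((+ 2) * + j + + 1) * + B          ∎
  where
  A = SB m (+ j - + 1) r
  B = SB m (+ j) r
SB-recurrence {r} {m} -[1+ j ] _ = begin
  + SB (suc m) -[1+ j ] r                  ≡⟨ cong +_ (SB-negative (suc m) j r) ⟩
  + 0                                      ≡⟨ sym (trans (ℤ.+-identityˡ _) (ℤ.*-zeroʳ ((+ 2) * -[1+ j ] + + 1))) ⟩
  + 0 + ((+ 2) * -[1+ j ] + + 1) * + 0     ≡⟨ cong₂ (λ a b → + a + ((+ 2) * -[1+ j ] + + 1) * + b)
                                                    (SB-negative m (suc (j ℕ.+ 0)) r) (SB-negative m j r) ⟨
  + SB m (-[1+ j ] - + 1) r + ((+ 2) * -[1+ j ] + + 1) * + SB m -[1+ j ] r ∎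

proposition3p2 : (r n : ℕ) (k : ℤ) →
    (n < r → SB n k r ≡ 0) ×
    (n ≡ r → SB n k r ≡ δ k (+ r)) ×
    (r < n → + SB n k r ≡ + SB (n ∸ 1) (k - + 1) r + ((+ 2) * k + + 1) * + SB (n ∸ 1) k r)
proposition3p2 r n k = SB-short k , (λ { refl → SB-diagonal r k }) , λ { (s≤s r≤m) → SB-recurrence k r≤m }
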